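{- In the setting below, for every $i=1,2,\dots,9$, $$[\Psi^{ -fc}_{ab}(F\mid ed,f)]_{[i]}=M[i,2]\cdot\Psi(K-d).$$ (That is, the maximal matchings counted contain $ed$, do not contain $fc$, and cover $f$.)
   Context: A matching is maximal if it is not contained in a larger matching; $\Psi(X)$ is the number of maximal matchings of a graph $X$ (the empty graph has one). For a graph $X$ and collections $A,B$ of vertices and edges of $X$, $\Psi^{ -A}(X\mid B)$ is the number of maximal matchings of $X$ that cover every vertex in $B$, contain every edge in $B$, leave every vertex in $A$ uncovered and contain no edge in $A$ (omitted $A$ or $B$ means no such constraint). $X-v$ deletes a vertex, $X-uv$ deletes an edge; $\Psi(X-v)$ counts maximal matchings of the subgraph $X-v$. For an edge $xy$ of $X$, $\Psi^{ -A}_{xy}(X\mid B)=(\Psi^{ -A}(X\mid B),\Psi^{ -A}(X-x\mid B),\Psi^{ -A}(X-y\mid B),\Psi^{ -A}(X-x-y\mid B),\Psi^{ -A}(X\mid x,y,B),\Psi^{ -A}(X-x\mid y,B),\Psi^{ -A}(X-y\mid x,B),\Psi^{ -A}(X\mid x,B),\Psi^{ -A}(X\mid y,B))^T$; $[v]_{[i]}$ is its $i$-th component and $M[i,j]$ the $(i,j)$ entry of $M$. Setting. $H$ is a hexagonal ring: a 2-connected plane graph with hexagons $H_1,\dots,H_n$ arranged cyclically, $H_{i-1},H_i$ sharing exactly one edge $e_i$ ($i=2,\dots,n$), $H_n,H_1$ sharing exactly one edge $e_1$, no other pairs sharing edges, each vertex on at most two hexagons. With a fixed planar embedding, $k_i\in\{1,2,3\}$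 is the number of edges of $H_i$ strictly between $e_i$ and $e_{i+1}$ when $H_i$ is traversed clockwise from $e_i$ (indices mod $n$), $M_i=t(k_i)$, $f(t(1))=L$, $f(t(2))=S$, $f(t(3))=R$, and $M=f(M_1)f(M_2)\cdots f(M_n)$, where $S=\begin{pmatrix}1&1&1&1&1&1&1&0&0\\0&1&0&1&0&0&1&1&0\\0&0&1&1&0&1&0&0&1\\0&0&0&1&1&1&1&0&0\\1&0&0&1&1&1&1&0&0\\0&1&0&0&0&0&0&1&0\\0&0&1&0&0&0&0&0&1\\1&0&1&1&1&1&1&0&0\\1&1&0&1&1&1&1&0&0\end{pmatrix}$, $L=\begin{pmatrix}1&1&1&1&1&1&1&0&0\\1&0&1&0&0&0&0&0&1\\0&1&0&1&0&0&1&1&0\\1&0&1&0&0&0&0&0&0\\1&0&1&1&0&1&0&0&0\\0&0&1&0&0&0&0&0&1\\0&1&0&1&0&0&0&0&0\\1&1&1&1&0&1&0&0&0\\1&0&1&1&1&1&1&0&0\end{pmatrix}$, $R=\begin{pmatrix}1&1&1&1&1&1&1&0&0\\0&0&1&1&0&1&0&0&1\\1&1&0&0&0&0&0&1&0\\1&1&0&0&0&0&0&0&0\\1&1&0&1&0&0&1&0&0\\0&0&1&1&0&0&0&0&0\\0&1&0&0&0&0&0&1&0\\1&1&0&1&1&1&1&0&0\\1&1&1&1&0&0&1&0&0\end{pmatrix}$. Write $e_1=dc$, where $d$ precedes $c$ when $H_n$ is traversed clockwise; $e$ is the neighbour of $d$ on $H_n$ other than $c$, and $f$ is the neighbour of $c$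 on $H_n$ other than $d$. $G$ is the hexagonal chain obtained by cutting $H$ along $dc$: $d,c$ and the edge $dc$ stay with $H_n$, while on $H_1$ they are replaced by new vertices $a$ (copy of $d$) and $b$ (copy of $c$) joined by the edge $ab$, the edges of $H_1$ formerly incident to $d$ (resp. $c$) becoming incident to $a$ (resp. $b$). $K$ is an arbitrary graph containing the edge $dc$ with $V(K)\cap V(G)=\{d,c\}$ and $E(K)\cap E(G)=\{dc\}$, and $F=G\cup K$. -}

module Defs where

open import Data.Nat using (ℕ; zero; suc; _+_; _*_; _≡ᵇ_; _≤_)
open import Data.Bool using (Bool; true; false; _∧_; _∨_; not; if_then_else_)
open import Data.Product using (_×_; _,_; proj₁; proj₂)
open import Data.Sum using (_⊎_)
open import Data.List using (List; []; _∷_; _++_; map; filter; length)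
open import Data.Bool.ListAction using (all; any)
open import Data.List.Relation.Unary.All using (All)
open import Data.List.Relation.Unary.Any using (Any)
open import Data.List.Relation.Unary.AllPairs using (AllPairs)
open import Data.Fin using (Fin; zero; suc)
open import Data.Vec using (Vec; []; _∷_; lookup; tabulate; sum)
open import Relation.Binary.PropositionalEquality using (_≡_; _≢_)
open import Relation.Nullary using (¬_)

-- A (finite, simple) graph is given by its list of edges; an
-- edge is an (unordered) pair of vertex labels from ℕ, stored as an
-- ordered pair.  Isolated vertices never influence the quantities
-- below, so they are not recorded.

Edge : Set
Edge = ℕ × ℕ

SameEdge : Edge → Edge → Set
SameEdge (u , v) (u' , v') = (u ≡ u' × v ≡ v') ⊎ (u ≡ v' × v ≡ u')

Simple : List Edge → Set
Simple E = All (λ e → proj₁ e ≢ proj₂ e) E × AllPairs (λ e e' → ¬ SameEdge e e') E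

_∈E_ : Edge → List Edge → Set
e ∈E E = Any (SameEdge e) E

sameEdgeᵇ : Edge → Edge → Bool
sameEdgeᵇ (u , v) (u' , v') = ((u ≡ᵇ u') ∧ (v ≡ᵇ v')) ∨ ((u ≡ᵇ v') ∧ (v ≡ᵇ u'))

incident : Edge → ℕ → Bool
incident (u , v) w = (u ≡ᵇ w) ∨ (v ≡ᵇ w)

sharesVertex : Edge → Edge → Bool
sharesVertex (u , v) e = incident e u ∨ incident e v

covers : List Edge → ℕ → Bool
covers M w = any (λ e → incident e w) M

hasEdge : List Edge → Edge → Bool
hasEdge M e = any (sameEdgeᵇ e) M

isMatching : List Edge → Bool
isMatching [] = true
isMatching (e ∷ M) = not (any (sharesVertex e) M) ∧ isMatching M

-- all sub-lists (= all edge subsets, for a list without repetitions)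
sublists : {A : Set} → List A → List (List A)
sublists [] = [] ∷ []
sublists (x ∷ xs) = let r = sublists xs in r ++ map (x ∷_) r

countTrue : List Bool → ℕ
countTrue [] = 0
countTrue (true ∷ bs) = suc (countTrue bs)
countTrue (false ∷ bs) = countTrue bs

-- Ψ^{-A}(X - D | B)
--   E       : edge list of X
--   D       : deleted vertices (X - D is X with these vertices and all
--             incident edges removed)
--   Av, Ae  : vertices that must be uncovered / edges that must be absent
--   Bv, Be  : vertices that must be covered / edges that must be present
-- It is the number of maximal matchings M of X - D (edge sets of X - D
-- that are matchings and such that every edge of X - D has an endpoint
-- covered by M) satisfying the constraints.

edgesMinus : List Edge → List ℕ → List Edge
edgesMinus E D = filter (λ e → Data.Bool.T? (not (any (incident e) D))) E
  where import Data.Bool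

isMaximalMatchingIn : List Edge → List Edge → Bool
isMaximalMatchingIn E' M =
  isMatching M ∧ all (λ e → covers M (proj₁ e) ∨ covers M (proj₂ e)) E'

Ψ : (E : List Edge) (D : List ℕ) (Av : List ℕ) (Ae : List Edge)
    (Bv : List ℕ) (Be : List Edge) → ℕ
Ψ E D Av Ae Bv Be =
  countTrue (map ok (sublists (edgesMinus E D)))
  where
  ok : List Edge → Bool
  ok M = isMaximalMatchingIn (edgesMinus E D) M
       ∧ all (covers M) Bv ∧ all (hasEdge M) Be
       ∧ all (λ v → not (covers M v)) Av ∧ all (λ e → not (hasEdge M e)) Ae

-- Ψ^{-A}_{xy}(X | B), as a function of the component index (Fin 9,
-- index 0 = component [1]).
Ψvec : (E : List Edge) (x y : ℕ) (Av : List ℕ) (Ae : List Edge)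
       (Bv : List ℕ) (Be : List Edge) → Fin 9 → ℕ
Ψvec E x y Av Ae Bv Be zero = Ψ E [] Av Ae Bv Be
Ψvec E x y Av Ae Bv Be (suc zero) = Ψ E (x ∷ []) Av Ae Bv Be
Ψvec E x y Av Ae Bv Be (suc (suc zero)) = Ψ E (y ∷ []) Av Ae Bv Be
Ψvec E x y Av Ae Bv Be (suc (suc (suc zero))) = Ψ E (x ∷ y ∷ []) Av Ae Bv Be
Ψvec E x y Av Ae Bv Be (suc (suc (suc (suc zero)))) = Ψ E [] Av Ae (x ∷ y ∷ Bv) Be
Ψvec E x y Av Ae Bv Be (suc (suc (suc (suc (suc zero))))) = Ψ E (x ∷ []) Av Ae (y ∷ Bv) Be
Ψvec E x y Av Ae Bv Be (suc (suc (suc (suc (suc (suc zero)))))) = Ψ E (y ∷ []) Av Ae (x ∷ Bv) Be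
Ψvec E x y Av Ae Bv Be (suc (suc (suc (suc (suc (suc (suc zero))))))) = Ψ E [] Av Ae (x ∷ Bv) Be
Ψvec E x y Av Ae Bv Be (suc (suc (suc (suc (suc (suc (suc (suc zero)))))))) = Ψ E [] Av Ae (y ∷ Bv) Be

Mat : Set
Mat = Fin 9 → Fin 9 → ℕ

fromRows : Vec (Vec ℕ 9) 9 → Mat
fromRows rows i j = lookup (lookup rows i) j

_⊗_ : Mat → Mat → Mat
(A ⊗ B) i j = sum (tabulate (λ k → A i k * B k j))

idM : {m : ℕ} → Fin m → Fin m → ℕ
idM zero zero = 1
idM (suc i) (suc j) = idM i j
idM zero (suc j) = 0
idM (suc i) zero = 0

I₉ : Mat
I₉ = idM

Smat Lmat Rmat : Mat
Smat = fromRows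
  ( (1 ∷ 1 ∷ 1 ∷ 1 ∷ 1 ∷ 1 ∷ 1 ∷ 0 ∷ 0 ∷ [])
  ∷ (0 ∷ 1 ∷ 0 ∷ 1 ∷ 0 ∷ 0 ∷ 1 ∷ 1 ∷ 0 ∷ [])
  ∷ (0 ∷ 0 ∷ 1 ∷ 1 ∷ 0 ∷ 1 ∷ 0 ∷ 0 ∷ 1 ∷ [])
  ∷ (0 ∷ 0 ∷ 0 ∷ 1 ∷ 1 ∷ 1 ∷ 1 ∷ 0 ∷ 0 ∷ [])
  ∷ (1 ∷ 0 ∷ 0 ∷ 1 ∷ 1 ∷ 1 ∷ 1 ∷ 0 ∷ 0 ∷ [])
  ∷ (0 ∷ 1 ∷ 0 ∷ 0 ∷ 0 ∷ 0 ∷ 0 ∷ 1 ∷ 0 ∷ [])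
  ∷ (0 ∷ 0 ∷ 1 ∷ 0 ∷ 0 ∷ 0 ∷ 0 ∷ 0 ∷ 1 ∷ [])
  ∷ (1 ∷ 0 ∷ 1 ∷ 1 ∷ 1 ∷ 1 ∷ 1 ∷ 0 ∷ 0 ∷ [])
  ∷ (1 ∷ 1 ∷ 0 ∷ 1 ∷ 1 ∷ 1 ∷ 1 ∷ 0 ∷ 0 ∷ [])
  ∷ [])
Lmat = fromRows
  ( (1 ∷ 1 ∷ 1 ∷ 1 ∷ 1 ∷ 1 ∷ 1 ∷ 0 ∷ 0 ∷ [])
  ∷ (1 ∷ 0 ∷ 1 ∷ 0 ∷ 0 ∷ 0 ∷ 0 ∷ 0 ∷ 1 ∷ [])
  ∷ (0 ∷ 1 ∷ 0 ∷ 1 ∷ 0 ∷ 0 ∷ 1 ∷ 1 ∷ 0 ∷ [])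
  ∷ (1 ∷ 0 ∷ 1 ∷ 0 ∷ 0 ∷ 0 ∷ 0 ∷ 0 ∷ 0 ∷ [])
  ∷ (1 ∷ 0 ∷ 1 ∷ 1 ∷ 0 ∷ 1 ∷ 0 ∷ 0 ∷ 0 ∷ [])
  ∷ (0 ∷ 0 ∷ 1 ∷ 0 ∷ 0 ∷ 0 ∷ 0 ∷ 0 ∷ 1 ∷ [])
  ∷ (0 ∷ 1 ∷ 0 ∷ 1 ∷ 0 ∷ 0 ∷ 0 ∷ 0 ∷ 0 ∷ [])
  ∷ (1 ∷ 1 ∷ 1 ∷ 1 ∷ 0 ∷ 1 ∷ 0 ∷ 0 ∷ 0 ∷ [])
  ∷ (1 ∷ 0 ∷ 1 ∷ 1 ∷ 1 ∷ 1 ∷ 1 ∷ 0 ∷ 0 ∷ [])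
  ∷ [])
Rmat = fromRows
  ( (1 ∷ 1 ∷ 1 ∷ 1 ∷ 1 ∷ 1 ∷ 1 ∷ 0 ∷ 0 ∷ [])
  ∷ (0 ∷ 0 ∷ 1 ∷ 1 ∷ 0 ∷ 1 ∷ 0 ∷ 0 ∷ 1 ∷ [])
  ∷ (1 ∷ 1 ∷ 0 ∷ 0 ∷ 0 ∷ 0 ∷ 0 ∷ 1 ∷ 0 ∷ [])
  ∷ (1 ∷ 1 ∷ 0 ∷ 0 ∷ 0 ∷ 0 ∷ 0 ∷ 0 ∷ 0 ∷ [])
  ∷ (1 ∷ 1 ∷ 0 ∷ 1 ∷ 0 ∷ 0 ∷ 1 ∷ 0 ∷ 0 ∷ [])
  ∷ (0 ∷ 0 ∷ 1 ∷ 1 ∷ 0 ∷ 0 ∷ 0 ∷ 0 ∷ 0 ∷ [])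
  ∷ (0 ∷ 1 ∷ 0 ∷ 0 ∷ 0 ∷ 0 ∷ 0 ∷ 1 ∷ 0 ∷ [])
  ∷ (1 ∷ 1 ∷ 0 ∷ 1 ∷ 1 ∷ 1 ∷ 1 ∷ 0 ∷ 0 ∷ [])
  ∷ (1 ∷ 1 ∷ 1 ∷ 1 ∷ 0 ∷ 0 ∷ 1 ∷ 0 ∷ 0 ∷ [])
  ∷ [])

-- Hexagonal rings, described by the sequence k_1,…,k_n ∈ {1,2,3}.

data Turn : Set where
  k1 k2 k3 : Turn

fM : Turn → Mat
fM k1 = Lmat
fM k2 = Smat
fM k3 = Rmat

ringMatrix : {n : ℕ} → Vec Turn n → Mat
ringMatrix [] = I₉
ringMatrix (t ∷ ts) = fM t ⊗ ringMatrix ts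

-- Vertex labelling of the chain G (cut along e_1 = dc).
-- Hexagon H_i, traversed clockwise starting with its edge e_i traversed
-- as x_i → y_i, is the 6-cycle
--     x_i, y_i, b_i, b_i+1, b_i+2, b_i+3, (back to x_i)
-- where b_i = 2 + 4(i-1) are its four new labels.  The k_i edges strictly
-- between e_i and e_{i+1} are the first k_i edges after y_i, so
-- e_{i+1} is traversed (clockwise in H_i) as u_i → w_i with
-- u_i = path[k_i], w_i = path[k_i+1], where path = hexPath x_i y_i b_i.
-- In H_{i+1} (clockwise) that shared edge is traversed in the opposite
-- direction, hence x_{i+1} = w_i, y_{i+1} = u_i.
-- Start: x_1 = b = 0, y_1 = a = 1 (the edge ab of H_1 is the copy of e_1).

hexPath : ℕ → ℕ → ℕ → Vec ℕ 6
hexPath x y b = y ∷ b ∷ suc b ∷ suc (suc b) ∷ suc (suc (suc b)) ∷ x ∷ []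

hexEdges : Vec ℕ 6 → List Edge
hexEdges (p0 ∷ p1 ∷ p2 ∷ p3 ∷ p4 ∷ p5 ∷ []) =
  (p0 , p1) ∷ (p1 , p2) ∷ (p2 , p3) ∷ (p3 , p4) ∷ (p4 , p5) ∷ []

uPos wPos : Turn → Fin 6
uPos k1 = suc zero
uPos k2 = suc (suc zero)
uPos k3 = suc (suc (suc zero))
wPos k1 = suc (suc zero)
wPos k2 = suc (suc (suc zero))
wPos k3 = suc (suc (suc (suc zero)))

chainEdges : ℕ → ℕ → ℕ → List Turn → List Edge
chainEdges x y b [] = []
chainEdges x y b (t ∷ ts) =
  hexEdges P ++ chainEdges (lookup P (wPos t)) (lookup P (uPos t)) (4 + b) ts
  where P = hexPath x y b

labelA labelB : ℕ
labelA = 1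
labelB = 0

chainG : List Turn → List Edge
chainG ts = (labelA , labelB) ∷ chainEdges labelB labelA 2 ts

-- number of vertices of G (labels 0 … 4n+1 are used)
nVertG : List Turn → ℕ
nVertG ts = 2 + 4 * length ts

lastHex : ℕ → ℕ → ℕ → Turn → List Turn → Vec ℕ 6 × Turn
lastHex x y b t [] = hexPath x y b , t
lastHex x y b t (t' ∷ ts) =
  lastHex (lookup P (wPos t)) (lookup P (uPos t)) (4 + b) t' ts
  where P = hexPath x y b

-- the labels of e, d, c, f on H_n (e, d, c, f are consecutive in
-- clockwise order, dc = e_1)
record EDCF : Set where
  constructor edcf
  field
    ve vd vc vf : ℕ

edcfOf : Vec ℕ 6 × Turn → EDCF
edcfOf (p0 ∷ p1 ∷ p2 ∷ p3 ∷ p4 ∷ p5 ∷ [] , k1) = edcf p0 p1 p2 p3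
edcfOf (p0 ∷ p1 ∷ p2 ∷ p3 ∷ p4 ∷ p5 ∷ [] , k2) = edcf p1 p2 p3 p4
edcfOf (p0 ∷ p1 ∷ p2 ∷ p3 ∷ p4 ∷ p5 ∷ [] , k3) = edcf p2 p3 p4 p5

-- (dummy value for the empty sequence, which never occurs: n ≥ 3)
ringEDCF : List Turn → EDCF
ringEDCF [] = edcf 0 0 0 0
ringEDCF (t ∷ ts) = edcfOf (lastHex labelB labelA 2 t ts)

-- K is an arbitrary simple graph with vertex
-- labels in ℕ and two distinguished adjacent vertices dK, cK (playing
-- the roles of d and c).  In F, dK ↦ d, cK ↦ c, and every other vertex
-- v of K ↦ N + v, where N is the number of vertices of G, so that
-- V(K) ∩ V(G) = {d, c}.

relabelK : (N d c dK cK : ℕ) → ℕ → ℕ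
relabelK N d c dK cK v =
  if v ≡ᵇ dK then d else (if v ≡ᵇ cK then c else N + v)

-- E(F) = E(G) ∪ E(K) (the common edge dc listed once)
glue : (EG : List Edge) (N d c : ℕ) (EK : List Edge) (dK cK : ℕ) → List Edge
glue EG N d c EK dK cK =
  EG ++ map (λ e → relabelK N d c dK cK (proj₁ e) , relabelK N d c dK cK (proj₂ e))
            (filter (λ e → Data.Bool.T? (not (sameEdgeᵇ e (dK , cK)))) EK)
  where import Data.Bool

-- A maximal matching of F = G ∪ K is assembled from matchings of the pieces ab + H₁, H₂, …, Hₙ and K,
-- which meet in the two-vertex interfaces e₂, …, eₙ and e₁ = dc.  Once it is fixed how the two vertices
-- of an interface are covered (by the piece before it, by the piece after it, or not at all), the two
-- sides can be counted independently, so the count factors through 9 interface states.  A fixed 9 × 9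
-- matrix intertwines the state-transfer matrix of a hexagon of turn k with f(t(k)); at the last hexagon
-- the constraints ed ∈ M and fc ∉ M only allow d to be covered by the hexagon, and summing the K-side
-- over the two remaining states of c gives Ψ(K − d).  The identities for the standard hexagon are
-- checked by evaluation, and relabelling carries them to every hexagon of the chain.

module Submission where

open import Defs
open import Data.Nat using (ℕ; zero; suc; _+_; _*_; _≡ᵇ_; _≤_; _<_; z≤n; s≤s; _≟_; _<?_)
open import Data.Nat.Properties
  using (+-assoc; +-comm; +-identityʳ; *-zeroʳ; *-assoc; *-distribˡ-+; *-distribʳ-+; ≡ᵇ⇒≡; ≡⇒≡ᵇ; <⇒≱; <⇒≢;
         <-≤-trans; ≤-trans; ≤-refl; ≤-reflexive; m≤n+m; m≤m+n; +-monoˡ-<; +-cancelʳ-≡; +-cancelˡ-≡; 1+n≢n;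
         m≤n⇒m≤1+n; n≤1+n)
open import Data.Nat.Tactic.RingSolver using (solve-∀)
open import Data.Bool using (Bool; true; false; _∧_; _∨_; not; T; T?)
open import Data.Bool.Properties
  using (∨-identityʳ; ∨-zeroʳ; ∧-identityʳ; ∧-zeroʳ; ∨-assoc; ∧-assoc; ∨-comm;
         ∧-commutativeMonoid; ∨-commutativeMonoid; ∨-∧-commutativeSemiring)
open import Data.Bool.ListAction using (all; any; and; or)
open import Data.Fin using (Fin; zero; suc)
open import Data.Vec using (Vec; []; _∷_; lookup; toList)
open import Data.Vec.Properties using (length-toList)
open import Data.List using (List; []; _∷_; _++_; map; filter; allFin)
open import Data.List.Properties using (map-++; map-cong; map-∘; ++-assoc; ++-identityʳ; filter-++; filter-all)
open import Data.List.Relation.Unary.All using (All; []; _∷_; all?)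
import Data.List.Relation.Unary.All as All
open import Data.List.Relation.Unary.All.Properties using (++⁺; map⁺; filter⁺; all-filter)
open import Data.List.Relation.Unary.Any using (Any; here; there)
open import Data.List.Membership.Propositional using (_∈_)
open import Data.List.Membership.Propositional.Properties using (∈-allFin)
open import Data.Product using (_×_; _,_; proj₁; proj₂)
open import Data.Sum using (_⊎_; inj₁; inj₂)
open import Data.Unit using (tt)
open import Data.Empty using (⊥-elim)
open import Function using (_∘_; _⇔_; mk⇔; Equivalence)
open import Relation.Nullary using (Dec; yes; no)
open import Relation.Nullary.Decidable using (True; False; toWitness; toWitnessFalse)
open import Relation.Unary using (Decidable; ∁)
open import Relation.Binary.PropositionalEquality
import Algebra.Solver.CommutativeMonoid as CMSolver
import Algebra.Solver.Ring.NaturalCoefficients.Default as SRSolver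

-- Finite sums

toℕ : Bool → ℕ
toℕ true = 1
toℕ false = 0

toℕ-∧ : ∀ x y → toℕ (x ∧ y) ≡ toℕ x * toℕ y
toℕ-∧ true true = refl
toℕ-∧ true false = refl
toℕ-∧ false y = refl

toℕ-∧-split : ∀ x y → toℕ (x ∧ y) + toℕ (not x ∧ y) ≡ toℕ y
toℕ-∧-split true y = +-identityʳ (toℕ y)
toℕ-∧-split false y = refl

∑ : {A : Set} → List A → (A → ℕ) → ℕ
∑ [] f = 0
∑ (x ∷ xs) f = f x + ∑ xs f
syntax ∑ xs (λ x → e) = ∑[ x ∈ xs ] e

private
  variable
    A B I : Set

countTrue≡∑ : (f : A → Bool) (xs : List A) → countTrue (map f xs) ≡ ∑[ x ∈ xs ] toℕ (f x)
countTrue≡∑ f [] = refl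
countTrue≡∑ f (x ∷ xs) with f x
... | true = cong suc (countTrue≡∑ f xs)
... | false = countTrue≡∑ f xs

∑-++ : (xs ys : List A) (f : A → ℕ) → ∑ (xs ++ ys) f ≡ ∑ xs f + ∑ ys f
∑-++ [] ys f = refl
∑-++ (x ∷ xs) ys f = trans (cong (f x +_) (∑-++ xs ys f)) (sym (+-assoc (f x) _ _))

∑-map : (g : A → B) (xs : List A) (f : B → ℕ) → ∑ (map g xs) f ≡ ∑[ x ∈ xs ] f (g x)
∑-map g [] f = refl
∑-map g (x ∷ xs) f = cong (f (g x) +_) (∑-map g xs f)

∑-cong : {P : A → Set} {f g : A → ℕ} → (∀ {x} → P x → f x ≡ g x) → ∀ {xs} → All P xs → ∑ xs f ≡ ∑ xs g
∑-cong f≡g [] = refl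
∑-cong f≡g (px ∷ pxs) = cong₂ _+_ (f≡g px) (∑-cong f≡g pxs)

∑-ext : {f g : A → ℕ} → (∀ x → f x ≡ g x) → ∀ xs → ∑ xs f ≡ ∑ xs g
∑-ext f≡g [] = refl
∑-ext f≡g (x ∷ xs) = cong₂ _+_ (f≡g x) (∑-ext f≡g xs)

∑-0 : (xs : List A) → ∑[ x ∈ xs ] 0 ≡ 0
∑-0 [] = refl
∑-0 (x ∷ xs) = ∑-0 xs

∑-+ : (xs : List A) (f g : A → ℕ) → ∑[ x ∈ xs ] (f x + g x) ≡ ∑ xs f + ∑ xs g
∑-+ [] f g = refl
∑-+ (x ∷ xs) f g = begin
  f x + g x + ∑[ x ∈ xs ] (f x + g x) ≡⟨ cong (f x + g x +_) (∑-+ xs f g) ⟩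
  f x + g x + (∑ xs f + ∑ xs g)       ≡⟨ +-assoc (f x) (g x) _ ⟩
  f x + (g x + (∑ xs f + ∑ xs g))     ≡⟨ cong (f x +_) (sym (+-assoc (g x) _ _)) ⟩
  f x + (g x + ∑ xs f + ∑ xs g)       ≡⟨ cong (λ m → f x + (m + ∑ xs g)) (+-comm (g x) _) ⟩
  f x + (∑ xs f + g x + ∑ xs g)       ≡⟨ cong (f x +_) (+-assoc (∑ xs f) _ _) ⟩
  f x + (∑ xs f + (g x + ∑ xs g))     ≡⟨ sym (+-assoc (f x) _ _) ⟩
  f x + ∑ xs f + (g x + ∑ xs g)       ∎
  where open ≡-Reasoning

∑-*ˡ : (c : ℕ) (xs : List A) (f : A → ℕ) → ∑[ x ∈ xs ] (c * f x) ≡ c * ∑ xs f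
∑-*ˡ c [] f = sym (*-zeroʳ c)
∑-*ˡ c (x ∷ xs) f = trans (cong (c * f x +_) (∑-*ˡ c xs f)) (sym (*-distribˡ-+ c (f x) _))

∑-*ʳ : (c : ℕ) (xs : List A) (f : A → ℕ) → ∑[ x ∈ xs ] (f x * c) ≡ ∑ xs f * c
∑-*ʳ c [] f = refl
∑-*ʳ c (x ∷ xs) f = trans (cong (f x * c +_) (∑-*ʳ c xs f)) (sym (*-distribʳ-+ c (f x) _))

∑-comm : (xs : List A) (ys : List B) (f : A → B → ℕ) →
         ∑[ x ∈ xs ] ∑[ y ∈ ys ] f x y ≡ ∑[ y ∈ ys ] ∑[ x ∈ xs ] f x y
∑-comm [] ys f = sym (∑-0 ys)
∑-comm (x ∷ xs) ys f =
  trans (cong (∑ ys (f x) +_) (∑-comm xs ys f)) (sym (∑-+ ys (f x) (λ y → ∑[ x ∈ xs ] f x y)))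

∑-*-∑ : (xs : List A) (ys : List B) (u : A → ℕ) (T : A → B → ℕ) (v : B → ℕ) →
        ∑[ x ∈ xs ] (u x * ∑[ y ∈ ys ] (T x y * v y)) ≡ ∑[ y ∈ ys ] (∑[ x ∈ xs ] (u x * T x y) * v y)
∑-*-∑ xs ys u T v = begin
  ∑[ x ∈ xs ] (u x * ∑[ y ∈ ys ] (T x y * v y))   ≡⟨ ∑-ext (λ x → sym (∑-*ˡ (u x) ys _)) xs ⟩
  ∑[ x ∈ xs ] ∑[ y ∈ ys ] (u x * (T x y * v y))   ≡⟨ ∑-comm xs ys _ ⟩
  ∑[ y ∈ ys ] ∑[ x ∈ xs ] (u x * (T x y * v y))   ≡⟨ ∑-ext (λ y → ∑-ext (λ x → sym (*-assoc (u x) _ _)) xs) ys ⟩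
  ∑[ y ∈ ys ] ∑[ x ∈ xs ] (u x * T x y * v y)     ≡⟨ ∑-ext (λ y → ∑-*ʳ (v y) xs _) ys ⟩
  ∑[ y ∈ ys ] (∑[ x ∈ xs ] (u x * T x y) * v y)   ∎
  where open ≡-Reasoning

All-sublists : {P : A → Set} {xs : List A} → All P xs → All (All P) (sublists xs)
All-sublists [] = [] ∷ []
All-sublists (px ∷ pxs) = ++⁺ (All-sublists pxs) (cons (All-sublists pxs))
  where
  cons : ∀ {Ms} → All (All _) Ms → All (All _) (map (_ ∷_) Ms)
  cons [] = []
  cons (pM ∷ pMs) = (px ∷ pM) ∷ cons pMs

sublists-map : (g : A → B) (xs : List A) → sublists (map g xs) ≡ map (map g) (sublists xs)
sublists-map g [] = refl
sublists-map g (x ∷ xs) rewrite sublists-map g xs =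
  sym (trans (map-++ (map g) (sublists xs) (map (x ∷_) (sublists xs))) (cong (map (map g) (sublists xs) ++_) (map-∷ (sublists xs))))
  where
  map-∷ : ∀ Ms → map (map g) (map (x ∷_) Ms) ≡ map (g x ∷_) (map (map g) Ms)
  map-∷ [] = refl
  map-∷ (M ∷ Ms) = cong (_ ∷_) (map-∷ Ms)

∑-sublists-++ : (xs ys : List A) (f : List A → ℕ) →
  ∑[ M ∈ sublists (xs ++ ys) ] f M ≡ ∑[ M₁ ∈ sublists xs ] ∑[ M₂ ∈ sublists ys ] f (M₁ ++ M₂)
∑-sublists-++ [] ys f = sym (+-identityʳ _)
∑-sublists-++ (x ∷ xs) ys f = begin
  ∑ (S ++ map (x ∷_) S) f                        ≡⟨ ∑-++ S _ f ⟩
  ∑ S f + ∑ (map (x ∷_) S) f                     ≡⟨ cong (∑ S f +_) (∑-map (x ∷_) S f) ⟩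
  ∑ S f + ∑[ M ∈ S ] f (x ∷ M)                   ≡⟨ cong₂ _+_ (∑-sublists-++ xs ys f) (∑-sublists-++ xs ys (λ M → f (x ∷ M))) ⟩
  ∑ S₁ F + ∑[ M₁ ∈ S₁ ] F (x ∷ M₁)               ≡⟨ cong (∑ S₁ F +_) (sym (∑-map (x ∷_) S₁ F)) ⟩
  ∑ S₁ F + ∑ (map (x ∷_) S₁) F                   ≡⟨ sym (∑-++ S₁ _ F) ⟩
  ∑ (S₁ ++ map (x ∷_) S₁) F                      ∎
  where
  open ≡-Reasoning
  S = sublists (xs ++ ys)
  S₁ = sublists xs
  F : List _ → ℕ
  F M₁ = ∑[ M₂ ∈ sublists ys ] f (M₁ ++ M₂)

∑-sublists-factor : (is : List I) {P₁ P₂ : A → Set} (xs ys : List A)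
  (f : List A → ℕ) (g₁ g₂ : I → List A → ℕ) → All P₁ xs → All P₂ ys →
  (∀ {M₁ M₂} → All P₁ M₁ → All P₂ M₂ → f (M₁ ++ M₂) ≡ ∑[ i ∈ is ] (g₁ i M₁ * g₂ i M₂)) →
  ∑[ M ∈ sublists (xs ++ ys) ] f M ≡ ∑[ i ∈ is ] (∑ (sublists xs) (g₁ i) * ∑ (sublists ys) (g₂ i))
∑-sublists-factor is xs ys f g₁ g₂ pxs pys split = begin
  ∑[ M ∈ sublists (xs ++ ys) ] f M                                  ≡⟨ ∑-sublists-++ xs ys f ⟩
  ∑[ M₁ ∈ S₁ ] ∑[ M₂ ∈ S₂ ] f (M₁ ++ M₂)                            ≡⟨ ∑-cong (λ p₁ → ∑-cong (split p₁) (All-sublists pys)) (All-sublists pxs) ⟩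
  ∑[ M₁ ∈ S₁ ] ∑[ M₂ ∈ S₂ ] ∑[ i ∈ is ] (g₁ i M₁ * g₂ i M₂)         ≡⟨ ∑-ext (λ M₁ → ∑-comm S₂ is _) S₁ ⟩
  ∑[ M₁ ∈ S₁ ] ∑[ i ∈ is ] ∑[ M₂ ∈ S₂ ] (g₁ i M₁ * g₂ i M₂)         ≡⟨ ∑-comm S₁ is _ ⟩
  ∑[ i ∈ is ] ∑[ M₁ ∈ S₁ ] ∑[ M₂ ∈ S₂ ] (g₁ i M₁ * g₂ i M₂)         ≡⟨ ∑-ext (λ i → ∑-ext (λ M₁ → ∑-*ˡ (g₁ i M₁) S₂ (g₂ i)) S₁) is ⟩
  ∑[ i ∈ is ] ∑[ M₁ ∈ S₁ ] (g₁ i M₁ * ∑ S₂ (g₂ i))                  ≡⟨ ∑-ext (λ i → ∑-*ʳ (∑ S₂ (g₂ i)) S₁ (g₁ i)) is ⟩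
  ∑[ i ∈ is ] (∑ S₁ (g₁ i) * ∑ S₂ (g₂ i))                           ∎
  where
  open ≡-Reasoning
  S₁ = sublists xs
  S₂ = sublists ys

∑-sublists-filter : {P : A → Set} (P? : Decidable P) (f : List A → ℕ) →
  (∀ {M} → Any (∁ P) M → f M ≡ 0) → ∀ xs → ∑ (sublists xs) f ≡ ∑ (sublists (filter P? xs)) f
∑-sublists-filter P? f vanish [] = refl
∑-sublists-filter P? f vanish (x ∷ xs) with P? x
... | yes px = begin
  ∑ (S ++ map (x ∷_) S) f                      ≡⟨ ∑-++ S _ f ⟩
  ∑ S f + ∑ (map (x ∷_) S) f                   ≡⟨ cong (∑ S f +_) (∑-map (x ∷_) S f) ⟩
  ∑ S f + ∑[ M ∈ S ] f (x ∷ M)                 ≡⟨ cong₂ _+_ (∑-sublists-filter P? f vanish xs)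
                                                    (∑-sublists-filter P? (f ∘ (x ∷_)) (vanish ∘ there) xs) ⟩
  ∑ S′ f + ∑[ M ∈ S′ ] f (x ∷ M)               ≡⟨ cong (∑ S′ f +_) (sym (∑-map (x ∷_) S′ f)) ⟩
  ∑ S′ f + ∑ (map (x ∷_) S′) f                 ≡⟨ sym (∑-++ S′ _ f) ⟩
  ∑ (S′ ++ map (x ∷_) S′) f                    ∎
  where
  open ≡-Reasoning
  S = sublists xs
  S′ = sublists (filter P? xs)
... | no ¬px = begin
  ∑ (S ++ map (x ∷_) S) f                      ≡⟨ ∑-++ S _ f ⟩
  ∑ S f + ∑ (map (x ∷_) S) f                   ≡⟨ cong (∑ S f +_) (trans (∑-map (x ∷_) S f) (trans (∑-ext (λ M → vanish (here ¬px)) S) (∑-0 S))) ⟩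
  ∑ S f + 0                                    ≡⟨ +-identityʳ _ ⟩
  ∑ S f                                        ≡⟨ ∑-sublists-filter P? f vanish xs ⟩
  ∑ (sublists (filter P? xs)) f                ∎
  where
  open ≡-Reasoning
  S = sublists xs

≡ᵇ-refl : ∀ m → (m ≡ᵇ m) ≡ true
≡ᵇ-refl m with m ≡ᵇ m in eq
... | true = refl
... | false = ⊥-elim (subst T eq (≡⇒≡ᵇ m m refl))

≡ᵇ-false : ∀ {m n} → m ≢ n → (m ≡ᵇ n) ≡ false
≡ᵇ-false {m} {n} m≢n with m ≡ᵇ n in eq
... | false = refl
... | true = ⊥-elim (m≢n (≡ᵇ⇒≡ m n (subst T (sym eq) tt)))

≡ᵇ-true : ∀ {m n} → (m ≡ᵇ n) ≡ true → m ≡ n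
≡ᵇ-true {m} {n} eq = ≡ᵇ⇒≡ m n (subst T (sym eq) tt)

≡ᵇ-resp-⇔ : ∀ {m n m′ n′} → m ≡ n ⇔ m′ ≡ n′ → (m ≡ᵇ n) ≡ (m′ ≡ᵇ n′)
≡ᵇ-resp-⇔ {m} {n} {m′} {n′} iff with m ≡ᵇ n in e | m′ ≡ᵇ n′ in e′
... | true | true = refl
... | false | false = refl
... | true | false = ⊥-elim (subst T e′ (≡⇒≡ᵇ m′ n′ (Equivalence.to iff (≡ᵇ-true e))))
... | false | true = ⊥-elim (subst T e (≡⇒≡ᵇ m n (Equivalence.from iff (≡ᵇ-true e′))))

infixr 4 _⇒_
_⇒_ : Bool → Bool → Bool
b ⇒ x = not b ∨ x

not-∨ : ∀ x y → not (x ∨ y) ≡ not x ∧ not y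
not-∨ true y = refl
not-∨ false y = refl

module _ {A : Set} (f : A → Bool) where

  any-++ : ∀ xs ys → any f (xs ++ ys) ≡ any f xs ∨ any f ys
  any-++ [] ys = refl
  any-++ (x ∷ xs) ys = trans (cong (f x ∨_) (any-++ xs ys)) (sym (∨-assoc (f x) _ _))

  all-++ : ∀ xs ys → all f (xs ++ ys) ≡ all f xs ∧ all f ys
  all-++ [] ys = refl
  all-++ (x ∷ xs) ys = trans (cong (f x ∧_) (all-++ xs ys)) (sym (∧-assoc (f x) _ _))

all-cong : {A : Set} {P : A → Set} {f g : A → Bool} → (∀ {x} → P x → f x ≡ g x) → ∀ {xs} → All P xs → all f xs ≡ all g xs
all-cong f≡g [] = refl
all-cong f≡g (px ∷ pxs) = cong₂ _∧_ (f≡g px) (all-cong f≡g pxs)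

module _ {A B : Set} {f : B → Bool} {g : A → B} {h : A → Bool} (fg≗h : ∀ x → f (g x) ≡ h x) where

  any-map : ∀ xs → any f (map g xs) ≡ any h xs
  any-map xs = trans (cong or (sym (map-∘ xs))) (cong or (map-cong fg≗h xs))

  all-map : ∀ xs → all f (map g xs) ≡ all h xs
  all-map xs = trans (cong and (sym (map-∘ xs))) (cong and (map-cong fg≗h xs))

∨-∧-factor : ∀ a b a′ b′ c d → ((a ∧ c) ∨ (b ∧ d)) ∨ ((a′ ∧ c) ∨ (b′ ∧ d)) ≡ ((a ∨ a′) ∧ c) ∨ ((b ∨ b′) ∧ d)
∨-∧-factor = solve 6 (λ a b a′ b′ c d → ((a :* c) :+ (b :* d)) :+ ((a′ :* c) :+ (b′ :* d))
                                     := ((a :+ a′) :* c) :+ ((b :+ b′) :* d)) refl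
  where open SRSolver ∨-∧-commutativeSemiring

module _ {A : Set} where

  any-∨ : (f g : A → Bool) (xs : List A) → any (λ x → f x ∨ g x) xs ≡ any f xs ∨ any g xs
  any-∨ f g [] = refl
  any-∨ f g (x ∷ xs) = trans (cong ((f x ∨ g x) ∨_) (any-∨ f g xs)) (swap (f x) (g x) (any f xs) (any g xs))
    where
    swap : ∀ a b c d → (a ∨ b) ∨ (c ∨ d) ≡ (a ∨ c) ∨ (b ∨ d)
    swap = solve 4 (λ a b c d → (a :+ b) :+ (c :+ d) := (a :+ c) :+ (b :+ d)) refl
      where open SRSolver ∨-∧-commutativeSemiring

  any-∧-∨ : (f g : A → Bool) (c d : Bool) (xs : List A) →
            any (λ x → (f x ∧ c) ∨ (g x ∧ d)) xs ≡ (any f xs ∧ c) ∨ (any g xs ∧ d)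
  any-∧-∨ f g c d [] = refl
  any-∧-∨ f g c d (x ∷ xs) =
    trans (cong (((f x ∧ c) ∨ (g x ∧ d)) ∨_) (any-∧-∨ f g c d xs)) (∨-∧-factor (f x) (g x) (any f xs) (any g xs) c d)

-- Matchings with externally covered vertices

_∈ᵇ_ : ℕ → List ℕ → Bool
v ∈ᵇ X = any (v ≡ᵇ_) X

uncovered : List Edge → ℕ → Bool
uncovered M v = not (covers M v)

coveredBy : List Edge → List ℕ → ℕ → Bool
coveredBy M X v = covers M v ∨ v ∈ᵇ X

dominatedBy : List Edge → List ℕ → Edge → Bool
dominatedBy M X e = coveredBy M X (proj₁ e) ∨ coveredBy M X (proj₂ e)

-- X lists vertices covered from outside S: a matching must leave them uncovered, but they count as
-- covered both for maximality and for the requirement Bv.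

Admissible : (S : List Edge) (X Av : List ℕ) (Ae : List Edge) (Bv : List ℕ) (Be : List Edge) → List Edge → Bool
Admissible S X Av Ae Bv Be M =
  (isMatching M ∧ all (uncovered M) X ∧ all (dominatedBy M X) S)
  ∧ all (coveredBy M X) Bv ∧ all (hasEdge M) Be ∧ all (uncovered M) Av ∧ all (not ∘ hasEdge M) Ae

Φ : (S : List Edge) (X Av : List ℕ) (Ae : List Edge) (Bv : List ℕ) (Be : List Edge) → ℕ
Φ S X Av Ae Bv Be = ∑[ M ∈ sublists S ] toℕ (Admissible S X Av Ae Bv Be M)

Φ-cong : ∀ {S Ae Be X X′ Av Av′ Bv Bv′} → X ≡ X′ → Av ≡ Av′ → Bv ≡ Bv′ → Φ S X Av Ae Bv Be ≡ Φ S X′ Av′ Ae Bv′ Be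
Φ-cong refl refl refl = refl

Ψ≡Φ : ∀ E D Av Ae Bv Be → Ψ E D Av Ae Bv Be ≡ Φ (edgesMinus E D) [] Av Ae Bv Be
Ψ≡Φ E D Av Ae Bv Be =
  trans (countTrue≡∑ _ (sublists S)) (∑-ext (λ M → cong toℕ (no-external M)) (sublists S))
  where
  S = edgesMinus E D
  no-external : ∀ M →
    (isMaximalMatchingIn S M ∧ all (covers M) Bv ∧ all (hasEdge M) Be
      ∧ all (λ v → not (covers M v)) Av ∧ all (λ e → not (hasEdge M e)) Ae)
    ≡ Admissible S [] Av Ae Bv Be M
  no-external M = cong₂ (λ dom cov → (isMatching M ∧ dom) ∧ cov ∧ all (hasEdge M) Be ∧ all (uncovered M) Av ∧ all (not ∘ hasEdge M) Ae)
    (cong and (map-cong (λ e → sym (cong₂ _∨_ (∨-identityʳ (covers M (proj₁ e))) (∨-identityʳ (covers M (proj₂ e))))) S))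
    (cong and (map-cong (λ v → sym (∨-identityʳ (covers M v))) Bv))

covers-++ : ∀ M₁ M₂ v → covers (M₁ ++ M₂) v ≡ covers M₁ v ∨ covers M₂ v
covers-++ M₁ M₂ v = any-++ (λ e → incident e v) M₁ M₂

hasEdge-++ : ∀ M₁ M₂ e → hasEdge (M₁ ++ M₂) e ≡ hasEdge M₁ e ∨ hasEdge M₂ e
hasEdge-++ M₁ M₂ e = any-++ (sameEdgeᵇ e) M₁ M₂

Misses : ℕ → Edge → Set
Misses v e = proj₁ e ≢ v × proj₂ e ≢ v

covers-miss : ∀ {M v} → All (Misses v) M → covers M v ≡ false
covers-miss [] = refl
covers-miss ((a≢v , b≢v) ∷ misses) = cong₂ _∨_ (cong₂ _∨_ (≡ᵇ-false a≢v) (≡ᵇ-false b≢v)) (covers-miss misses)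

∈ᵇ-miss : ∀ {X v} → All (_≢ v) X → v ∈ᵇ X ≡ false
∈ᵇ-miss [] = refl
∈ᵇ-miss (x≢v ∷ misses) = cong₂ _∨_ (≡ᵇ-false (≢-sym x≢v)) (∈ᵇ-miss misses)

hasEdge-miss₁ : ∀ {M u v} → All (Misses u) M → hasEdge M (u , v) ≡ false
hasEdge-miss₁ [] = refl
hasEdge-miss₁ {(a , b) ∷ M} {u} {v} ((a≢u , b≢u) ∷ misses) =
  cong₂ _∨_ (cong₂ _∨_ (cong (_∧ (v ≡ᵇ b)) (≡ᵇ-false (≢-sym a≢u))) (cong (_∧ (v ≡ᵇ a)) (≡ᵇ-false (≢-sym b≢u))))
            (hasEdge-miss₁ {u = u} {v} misses)

hasEdge-miss₂ : ∀ {M u v} → All (Misses v) M → hasEdge M (u , v) ≡ false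
hasEdge-miss₂ [] = refl
hasEdge-miss₂ {(a , b) ∷ M} {u} {v} ((a≢v , b≢v) ∷ misses) =
  cong₂ _∨_ (cong₂ _∨_ (trans (cong ((u ≡ᵇ a) ∧_) (≡ᵇ-false (≢-sym b≢v))) (∧-zeroʳ _))
                       (trans (cong ((u ≡ᵇ b) ∧_) (≡ᵇ-false (≢-sym a≢v))) (∧-zeroʳ _)))
            (hasEdge-miss₂ {u = u} {v} misses)

clash : List Edge → List Edge → Bool
clash M₁ M₂ = any (λ e → any (sharesVertex e) M₂) M₁

isMatching-++ : ∀ M₁ M₂ → isMatching (M₁ ++ M₂) ≡ (isMatching M₁ ∧ isMatching M₂) ∧ not (clash M₁ M₂)
isMatching-++ [] M₂ = sym (∧-identityʳ (isMatching M₂))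
isMatching-++ (e ∷ M₁) M₂ = begin
  not (any (sharesVertex e) (M₁ ++ M₂)) ∧ isMatching (M₁ ++ M₂)
    ≡⟨ cong₂ (λ s m → not s ∧ m) (any-++ (sharesVertex e) M₁ M₂) (isMatching-++ M₁ M₂) ⟩
  not (s₁ ∨ s₂) ∧ (I₁ ∧ I₂) ∧ not C
    ≡⟨ cong (λ z → z ∧ (I₁ ∧ I₂) ∧ not C) (not-∨ s₁ s₂) ⟩
  (not s₁ ∧ not s₂) ∧ (I₁ ∧ I₂) ∧ not C
    ≡⟨ shuffle (not s₁) (not s₂) I₁ I₂ (not C) ⟩
  ((not s₁ ∧ I₁) ∧ I₂) ∧ (not s₂ ∧ not C)
    ≡⟨ cong (((not s₁ ∧ I₁) ∧ I₂) ∧_) (sym (not-∨ s₂ C)) ⟩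
  ((not s₁ ∧ I₁) ∧ I₂) ∧ not (s₂ ∨ C) ∎
  where
  open ≡-Reasoning
  open CMSolver ∧-commutativeMonoid
  s₁ = any (sharesVertex e) M₁
  s₂ = any (sharesVertex e) M₂
  I₁ = isMatching M₁
  I₂ = isMatching M₂
  C = clash M₁ M₂
  shuffle : ∀ a b c d z → (a ∧ b) ∧ (c ∧ d) ∧ z ≡ ((a ∧ c) ∧ d) ∧ (b ∧ z)
  shuffle = solve 5 (λ a b c d z → (a ⊕ b) ⊕ (c ⊕ d) ⊕ z ⊜ ((a ⊕ c) ⊕ d) ⊕ (b ⊕ z)) refl

mapEdge : (ℕ → ℕ) → Edge → Edge
mapEdge φ e = φ (proj₁ e) , φ (proj₂ e)

module Relabel (φ : ℕ → ℕ) (φ-injective : ∀ {a b} → φ a ≡ φ b → a ≡ b) where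

  private
    φᴱ : Edge → Edge
    φᴱ = mapEdge φ

  φ-≡ᵇ : ∀ a b → (φ a ≡ᵇ φ b) ≡ (a ≡ᵇ b)
  φ-≡ᵇ a b = ≡ᵇ-resp-⇔ (mk⇔ φ-injective (cong φ))

  covers-relabel : ∀ M v → covers (map φᴱ M) (φ v) ≡ covers M v
  covers-relabel M v = any-map (λ e → cong₂ _∨_ (φ-≡ᵇ (proj₁ e) v) (φ-≡ᵇ (proj₂ e) v)) M

  coveredBy-relabel : ∀ M X v → coveredBy (map φᴱ M) (map φ X) (φ v) ≡ coveredBy M X v
  coveredBy-relabel M X v = cong₂ _∨_ (covers-relabel M v) (any-map (φ-≡ᵇ v) X)

  hasEdge-relabel : ∀ M e → hasEdge (map φᴱ M) (φᴱ e) ≡ hasEdge M e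
  hasEdge-relabel M (a , b) = any-map (λ (c , d) →
    cong₂ _∨_ (cong₂ _∧_ (φ-≡ᵇ a c) (φ-≡ᵇ b d)) (cong₂ _∧_ (φ-≡ᵇ a d) (φ-≡ᵇ b c))) M

  isMatching-relabel : ∀ M → isMatching (map φᴱ M) ≡ isMatching M
  isMatching-relabel [] = refl
  isMatching-relabel ((a , b) ∷ M) = cong₂ (λ s m → not s ∧ m)
    (any-map (λ (c , d) → cong₂ _∨_ (cong₂ _∨_ (φ-≡ᵇ c a) (φ-≡ᵇ d a)) (cong₂ _∨_ (φ-≡ᵇ c b) (φ-≡ᵇ d b))) M)
    (isMatching-relabel M)

  Admissible-relabel : ∀ S X Av Ae Bv Be M →
    Admissible (map φᴱ S) (map φ X) (map φ Av) (map φᴱ Ae) (map φ Bv) (map φᴱ Be) (map φᴱ M)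
    ≡ Admissible S X Av Ae Bv Be M
  Admissible-relabel S X Av Ae Bv Be M =
    cong₂ _∧_
      (cong₂ _∧_ (isMatching-relabel M)
        (cong₂ _∧_ (all-map (λ v → cong not (covers-relabel M v)) X)
                   (all-map (λ e → cong₂ _∨_ (coveredBy-relabel M X (proj₁ e)) (coveredBy-relabel M X (proj₂ e))) S)))
      (cong₂ _∧_ (all-map (coveredBy-relabel M X) Bv)
        (cong₂ _∧_ (all-map (hasEdge-relabel M) Be)
          (cong₂ _∧_ (all-map (λ v → cong not (covers-relabel M v)) Av)
                     (all-map (λ e → cong not (hasEdge-relabel M e)) Ae))))

  Φ-relabel : ∀ S X Av Ae Bv Be →
    Φ (map φᴱ S) (map φ X) (map φ Av) (map φᴱ Ae) (map φ Bv) (map φᴱ Be) ≡ Φ S X Av Ae Bv Be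
  Φ-relabel S X Av Ae Bv Be = begin
    ∑[ M ∈ sublists (map φᴱ S) ] toℕ (adm′ M)          ≡⟨ cong (λ Ms → ∑[ M ∈ Ms ] toℕ (adm′ M)) (sublists-map φᴱ S) ⟩
    ∑[ M ∈ map (map φᴱ) (sublists S) ] toℕ (adm′ M)    ≡⟨ ∑-map (map φᴱ) (sublists S) (toℕ ∘ adm′) ⟩
    ∑[ M ∈ sublists S ] toℕ (adm′ (map φᴱ M))          ≡⟨ ∑-ext (λ M → cong toℕ (Admissible-relabel S X Av Ae Bv Be M)) (sublists S) ⟩
    Φ S X Av Ae Bv Be                                  ∎
    where
    open ≡-Reasoning
    adm′ : List Edge → Bool
    adm′ = Admissible (map φᴱ S) (map φ X) (map φ Av) (map φᴱ Ae) (map φ Bv) (map φᴱ Be)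

  edgesMinus-relabel : ∀ L D → edgesMinus (map φᴱ L) (map φ D) ≡ map φᴱ (edgesMinus L D)
  edgesMinus-relabel [] D = refl
  edgesMinus-relabel (e ∷ L) D
    rewrite any-map {f = incident (φᴱ e)} (λ v → cong₂ _∨_ (φ-≡ᵇ (proj₁ e) v) (φ-≡ᵇ (proj₂ e) v)) D
    with not (any (incident e) D)
  ... | true = cong (φᴱ e ∷_) (edgesMinus-relabel L D)
  ... | false = edgesMinus-relabel L D

Φ-covered+uncovered : ∀ S X Av Ae Bv Be c → c ∈ᵇ X ≡ false →
  Φ S X Av Ae (c ∷ Bv) Be + Φ S X (c ∷ Av) Ae Bv Be ≡ Φ S X Av Ae Bv Be
Φ-covered+uncovered S X Av Ae Bv Be c c∉X =
  trans (sym (∑-+ (sublists S) _ _)) (∑-ext split (sublists S))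
  where
  open CMSolver ∧-commutativeMonoid
  split : ∀ M → toℕ (Admissible S X Av Ae (c ∷ Bv) Be M) + toℕ (Admissible S X (c ∷ Av) Ae Bv Be M)
              ≡ toℕ (Admissible S X Av Ae Bv Be M)
  split M = begin
    toℕ (Core ∧ ((covers M c ∨ c ∈ᵇ X) ∧ Cov) ∧ Has ∧ Unc ∧ Abs) + toℕ (Core ∧ Cov ∧ Has ∧ (not (covers M c) ∧ Unc) ∧ Abs)
      ≡⟨ cong (λ z → toℕ (Core ∧ (z ∧ Cov) ∧ Has ∧ Unc ∧ Abs) + toℕ (Core ∧ Cov ∧ Has ∧ (not (covers M c) ∧ Unc) ∧ Abs)) (trans (cong (covers M c ∨_) c∉X) (∨-identityʳ _)) ⟩
    toℕ (Core ∧ (covers M c ∧ Cov) ∧ Has ∧ Unc ∧ Abs) + toℕ (Core ∧ Cov ∧ Has ∧ (not (covers M c) ∧ Unc) ∧ Abs)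
      ≡⟨ cong₂ _+_ (cong toℕ (pull (covers M c) Core Cov Has Unc Abs)) (cong toℕ (pull′ (not (covers M c)) Core Cov Has Unc Abs)) ⟩
    toℕ (covers M c ∧ Core ∧ Cov ∧ Has ∧ Unc ∧ Abs) + toℕ (not (covers M c) ∧ Core ∧ Cov ∧ Has ∧ Unc ∧ Abs)
      ≡⟨ toℕ-∧-split (covers M c) _ ⟩
    toℕ (Core ∧ Cov ∧ Has ∧ Unc ∧ Abs) ∎
    where
    open ≡-Reasoning
    Core = isMatching M ∧ all (uncovered M) X ∧ all (dominatedBy M X) S
    Cov = all (coveredBy M X) Bv
    Has = all (hasEdge M) Be
    Unc = all (uncovered M) Av
    Abs = all (not ∘ hasEdge M) Ae
    pull : ∀ x p b e v f → p ∧ (x ∧ b) ∧ e ∧ v ∧ f ≡ x ∧ p ∧ b ∧ e ∧ v ∧ f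
    pull = solve 6 (λ x p b e v f → p ⊕ (x ⊕ b) ⊕ e ⊕ v ⊕ f ⊜ x ⊕ p ⊕ b ⊕ e ⊕ v ⊕ f) refl
    pull′ : ∀ x p b e v f → p ∧ b ∧ e ∧ (x ∧ v) ∧ f ≡ x ∧ p ∧ b ∧ e ∧ v ∧ f
    pull′ = solve 6 (λ x p b e v f → p ⊕ b ⊕ e ⊕ (x ⊕ v) ⊕ f ⊜ x ⊕ p ⊕ b ⊕ e ⊕ v ⊕ f) refl

Avoids : List ℕ → Edge → Set
Avoids D e = T (not (any (incident e) D))

avoids? : (D : List ℕ) → Decidable (Avoids D)
avoids? D e = T? (not (any (incident e) D))

covers-Any : ∀ {v M} → Any (∁ (Avoids (v ∷ []))) M → covers M v ≡ true
covers-Any {v} {e ∷ M} (here ¬avoid) with incident e v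
... | true = refl
... | false = ⊥-elim (¬avoid tt)
covers-Any {v} {e ∷ M} (there p) = trans (cong (incident e v ∨_) (covers-Any p)) (∨-zeroʳ _)

covers-All : ∀ {v M} → All (Avoids (v ∷ [])) M → covers M v ≡ false
covers-All [] = refl
covers-All {v} {e ∷ M} (avoid ∷ avoids) with incident e v
... | false = covers-All avoids

dominatedBy-external : ∀ M v e → dominatedBy M (v ∷ []) e ≡ incident e v ∨ dominatedBy M [] e
dominatedBy-external M v (a , b) =
  rearrange (covers M a) (covers M b) (a ≡ᵇ v) (b ≡ᵇ v)
  where
  open CMSolver ∨-commutativeMonoid
  rearrange : ∀ ca cb av bv → (ca ∨ (av ∨ false)) ∨ (cb ∨ (bv ∨ false)) ≡ (av ∨ bv) ∨ ((ca ∨ false) ∨ (cb ∨ false))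
  rearrange = solve 4 (λ ca cb av bv → (ca ⊕ (av ⊕ id)) ⊕ (cb ⊕ (bv ⊕ id)) ⊜ (av ⊕ bv) ⊕ ((ca ⊕ id) ⊕ (cb ⊕ id))) refl

all-dominatedBy-external : ∀ M v S → all (dominatedBy M (v ∷ [])) S ≡ all (dominatedBy M []) (edgesMinus S (v ∷ []))
all-dominatedBy-external M v [] = refl
all-dominatedBy-external M v (e ∷ S) rewrite dominatedBy-external M v e with incident e v
... | true = all-dominatedBy-external M v S
... | false = cong (dominatedBy M [] e ∧_) (all-dominatedBy-external M v S)

Φ-external≡delete : ∀ S v → Φ S (v ∷ []) [] [] [] [] ≡ Φ (edgesMinus S (v ∷ [])) [] [] [] [] []
Φ-external≡delete S v =
  trans (∑-sublists-filter (avoids? (v ∷ [])) (toℕ ∘ adm) vanish S)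
        (∑-cong (λ avoids → cong toℕ (agree avoids)) (All-sublists (all-filter (avoids? (v ∷ [])) S)))
  where
  adm : List Edge → Bool
  adm = Admissible S (v ∷ []) [] [] [] []
  vanish : ∀ {M} → Any (∁ (Avoids (v ∷ []))) M → toℕ (adm M) ≡ 0
  vanish {M} p rewrite covers-Any p with isMatching M
  ... | true = refl
  ... | false = refl
  agree : ∀ {M} → All (Avoids (v ∷ [])) M → adm M ≡ Admissible (edgesMinus S (v ∷ [])) [] [] [] [] [] M
  agree {M} avoids = cong₂ (λ c d → (isMatching M ∧ ((not c ∧ true) ∧ d)) ∧ true)
    (covers-All avoids) (all-dominatedBy-external M v S)

-- Splitting a count along a two-vertex interface

-- How a vertex of an interface {p, q} between S₁ and S₂ is covered: by an edge of S₁, by an edge of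
-- S₂, or not at all.

data Cover : Set where
  by₁ by₂ exposed : Cover

_==_ : Cover → Cover → Bool
by₁ == by₁ = true
by₂ == by₂ = true
exposed == exposed = true
_ == _ = false

State : Set
State = Cover × Cover

states : List State
states = (by₁ , by₁) ∷ (by₁ , by₂) ∷ (by₁ , exposed) ∷ (by₂ , by₁) ∷ (by₂ , by₂) ∷ (by₂ , exposed)
       ∷ (exposed , by₁) ∷ (exposed , by₂) ∷ (exposed , exposed) ∷ []

consIf : Bool → ℕ → List ℕ → List ℕ
consIf true v R = v ∷ R
consIf false v R = R

select : Cover → State → ℕ → ℕ → List ℕ → List ℕ
select c (s , t) p q R = consIf (s == c) p (consIf (t == c) q R)

map-consIf : ∀ (g : ℕ → ℕ) a v R → map g (consIf a v R) ≡ consIf a (g v) (map g R)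
map-consIf g true v R = refl
map-consIf g false v R = refl

map-select : ∀ (g : ℕ → ℕ) c σ p q R → map g (select c σ p q R) ≡ select c σ (g p) (g q) (map g R)
map-select g c (s , t) p q R = trans (map-consIf g (s == c) p _) (cong (consIf (s == c) (g p)) (map-consIf g (t == c) q R))

all-consIf : ∀ (f : ℕ → Bool) a b p q R → all f (consIf a p (consIf b q R)) ≡ (a ⇒ f p) ∧ (b ⇒ f q) ∧ all f R
all-consIf f true true p q R = refl
all-consIf f true false p q R = refl
all-consIf f false true p q R = refl
all-consIf f false false p q R = refl

pairConstraint : (n₁ n₂ a₁ a₂ x₁ x₂ cp cq : Bool) → Bool
pairConstraint n₁ n₂ a₁ a₂ x₁ x₂ cp cq =
  ((x₁ ⇒ not cp) ∧ (x₂ ⇒ not cq)) ∧ ((a₁ ⇒ cp ∨ x₁) ∧ (a₂ ⇒ cq ∨ x₂)) ∧ ((n₁ ⇒ not cp) ∧ (n₂ ⇒ not cq))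

fits₁ fits₂ : State → Bool → Bool → Bool
fits₁ (s , t) = pairConstraint (s == exposed) (t == exposed) (s == by₁) (t == by₁) (s == by₂) (t == by₂)
fits₂ (s , t) = pairConstraint (s == exposed) (t == exposed) (s == by₂) (t == by₂) (s == by₁) (t == by₁)

-- For each interface vertex exactly one state agrees with the way M₁ and M₂ cover it, unless both do.

states-collapse : ∀ (R₁ R₂ : Bool → Bool → Bool) c₁p c₁q c₂p c₂q →
  ∑[ σ ∈ states ] toℕ ((fits₁ σ c₁p c₁q ∧ fits₂ σ c₂p c₂q)
                       ∧ (R₁ (proj₁ σ == by₂) (proj₂ σ == by₂) ∧ R₂ (proj₁ σ == by₁) (proj₂ σ == by₁)))
  ≡ toℕ ((not (c₁p ∧ c₂p) ∧ not (c₁q ∧ c₂q)) ∧ (R₁ c₂p c₂q ∧ R₂ c₁p c₁q))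
states-collapse R₁ R₂ true true true true = +-identityʳ _
states-collapse R₁ R₂ true true true false = +-identityʳ _
states-collapse R₁ R₂ true true false true = +-identityʳ _
states-collapse R₁ R₂ true true false false = +-identityʳ _
states-collapse R₁ R₂ true false true true = +-identityʳ _
states-collapse R₁ R₂ true false true false = +-identityʳ _
states-collapse R₁ R₂ true false false true = +-identityʳ _
states-collapse R₁ R₂ true false false false = +-identityʳ _
states-collapse R₁ R₂ false true true true = +-identityʳ _
states-collapse R₁ R₂ false true true false = +-identityʳ _
states-collapse R₁ R₂ false true false true = +-identityʳ _
states-collapse R₁ R₂ false true false false = +-identityʳ _
states-collapse R₁ R₂ false false true true = +-identityʳ _
states-collapse R₁ R₂ false false true false = +-identityʳ _
states-collapse R₁ R₂ false false false true = +-identityʳ _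
states-collapse R₁ R₂ false false false false = +-identityʳ _

module PairConstraints (p q : ℕ) (p≢q : p ≢ q) where

  ∈ᵇ-consIf-p : ∀ a b X → p ∈ᵇ X ≡ false → p ∈ᵇ consIf a p (consIf b q X) ≡ a
  ∈ᵇ-consIf-p true b X p∉X = cong (_∨ p ∈ᵇ consIf b q X) (≡ᵇ-refl p)
  ∈ᵇ-consIf-p false true X p∉X = cong₂ _∨_ (≡ᵇ-false p≢q) p∉X
  ∈ᵇ-consIf-p false false X p∉X = p∉X

  ∈ᵇ-consIf-q : ∀ a b X → q ∈ᵇ X ≡ false → q ∈ᵇ consIf a p (consIf b q X) ≡ b
  ∈ᵇ-consIf-q true true X q∉X = cong₂ _∨_ (≡ᵇ-false (p≢q ∘ sym)) (cong (_∨ q ∈ᵇ X) (≡ᵇ-refl q))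
  ∈ᵇ-consIf-q true false X q∉X = cong₂ _∨_ (≡ᵇ-false (p≢q ∘ sym)) q∉X
  ∈ᵇ-consIf-q false true X q∉X = cong (_∨ q ∈ᵇ X) (≡ᵇ-refl q)
  ∈ᵇ-consIf-q false false X q∉X = q∉X

  ∈ᵇ-consIf-other : ∀ {v} a b X → v ≢ p → v ≢ q → v ∈ᵇ consIf a p (consIf b q X) ≡ v ∈ᵇ X
  ∈ᵇ-consIf-other true true X v≢p v≢q = cong₂ _∨_ (≡ᵇ-false v≢p) (cong₂ _∨_ (≡ᵇ-false v≢q) refl)
  ∈ᵇ-consIf-other true false X v≢p v≢q = cong₂ _∨_ (≡ᵇ-false v≢p) refl
  ∈ᵇ-consIf-other false true X v≢p v≢q = cong₂ _∨_ (≡ᵇ-false v≢q) refl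
  ∈ᵇ-consIf-other false false X v≢p v≢q = refl

  Residual : (S : List Edge) (X Av : List ℕ) (Ae : List Edge) (Bv : List ℕ) (Be : List Edge) →
             List Edge → Bool → Bool → Bool
  Residual S X Av Ae Bv Be M x₁ x₂ =
    isMatching M ∧ all (uncovered M) X ∧ all (dominatedBy M X′) S ∧ all (coveredBy M X′) Bv
      ∧ all (hasEdge M) Be ∧ all (uncovered M) Av ∧ all (not ∘ hasEdge M) Ae
    where X′ = consIf x₁ p (consIf x₂ q X)

  Admissible-consIf : ∀ S X Av Ae Bv Be M (n₁ n₂ a₁ a₂ x₁ x₂ : Bool) → p ∈ᵇ X ≡ false → q ∈ᵇ X ≡ false →
    Admissible S (consIf x₁ p (consIf x₂ q X)) (consIf n₁ p (consIf n₂ q Av)) Ae (consIf a₁ p (consIf a₂ q Bv)) Be M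
    ≡ pairConstraint n₁ n₂ a₁ a₂ x₁ x₂ (covers M p) (covers M q) ∧ Residual S X Av Ae Bv Be M x₁ x₂
  Admissible-consIf S X Av Ae Bv Be M n₁ n₂ a₁ a₂ x₁ x₂ p∉X q∉X = begin
    (IM ∧ all (uncovered M) X′ ∧ DS) ∧ all (coveredBy M X′) Bv′ ∧ BE ∧ all (uncovered M) Av′ ∧ AE
      ≡⟨ cong₂ (λ u w → (IM ∧ u ∧ DS) ∧ w) (all-consIf (uncovered M) x₁ x₂ p q X)
           (cong₂ (λ u w → u ∧ BE ∧ w ∧ AE) (all-consIf (coveredBy M X′) a₁ a₂ p q Bv) (all-consIf (uncovered M) n₁ n₂ p q Av)) ⟩
    (IM ∧ ((x₁ ⇒ not cp) ∧ (x₂ ⇒ not cq) ∧ UX) ∧ DS)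
      ∧ ((a₁ ⇒ cp ∨ p ∈ᵇ X′) ∧ (a₂ ⇒ cq ∨ q ∈ᵇ X′) ∧ CB) ∧ BE ∧ ((n₁ ⇒ not cp) ∧ (n₂ ⇒ not cq) ∧ UA) ∧ AE
      ≡⟨ cong₂ (λ u w → (IM ∧ ((x₁ ⇒ not cp) ∧ (x₂ ⇒ not cq) ∧ UX) ∧ DS)
                         ∧ ((a₁ ⇒ cp ∨ u) ∧ (a₂ ⇒ cq ∨ w) ∧ CB) ∧ BE ∧ ((n₁ ⇒ not cp) ∧ (n₂ ⇒ not cq) ∧ UA) ∧ AE)
           (∈ᵇ-consIf-p x₁ x₂ X p∉X) (∈ᵇ-consIf-q x₁ x₂ X q∉X) ⟩
    (IM ∧ ((x₁ ⇒ not cp) ∧ (x₂ ⇒ not cq) ∧ UX) ∧ DS)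
      ∧ ((a₁ ⇒ cp ∨ x₁) ∧ (a₂ ⇒ cq ∨ x₂) ∧ CB) ∧ BE ∧ ((n₁ ⇒ not cp) ∧ (n₂ ⇒ not cq) ∧ UA) ∧ AE
      ≡⟨ shuffle IM (x₁ ⇒ not cp) (x₂ ⇒ not cq) UX DS (a₁ ⇒ cp ∨ x₁) (a₂ ⇒ cq ∨ x₂) CB BE (n₁ ⇒ not cp) (n₂ ⇒ not cq) UA AE ⟩
    pairConstraint n₁ n₂ a₁ a₂ x₁ x₂ cp cq ∧ Residual S X Av Ae Bv Be M x₁ x₂ ∎
    where
    open ≡-Reasoning
    open CMSolver ∧-commutativeMonoid
    X′ = consIf x₁ p (consIf x₂ q X)
    Av′ = consIf n₁ p (consIf n₂ q Av)
    Bv′ = consIf a₁ p (consIf a₂ q Bv)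
    cp = covers M p
    cq = covers M q
    IM = isMatching M
    UX = all (uncovered M) X
    DS = all (dominatedBy M X′) S
    CB = all (coveredBy M X′) Bv
    BE = all (hasEdge M) Be
    UA = all (uncovered M) Av
    AE = all (not ∘ hasEdge M) Ae
    shuffle : ∀ im x₁ x₂ ux ds a₁ a₂ cb be n₁ n₂ ua ae →
      (im ∧ (x₁ ∧ x₂ ∧ ux) ∧ ds) ∧ (a₁ ∧ a₂ ∧ cb) ∧ be ∧ (n₁ ∧ n₂ ∧ ua) ∧ ae
      ≡ ((x₁ ∧ x₂) ∧ (a₁ ∧ a₂) ∧ (n₁ ∧ n₂)) ∧ im ∧ ux ∧ ds ∧ cb ∧ be ∧ ua ∧ ae
    shuffle = solve 13 (λ im x₁ x₂ ux ds a₁ a₂ cb be n₁ n₂ ua ae →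
      (im ⊕ (x₁ ⊕ x₂ ⊕ ux) ⊕ ds) ⊕ (a₁ ⊕ a₂ ⊕ cb) ⊕ be ⊕ (n₁ ⊕ n₂ ⊕ ua) ⊕ ae
      ⊜ ((x₁ ⊕ x₂) ⊕ (a₁ ⊕ a₂) ⊕ (n₁ ⊕ n₂)) ⊕ im ⊕ ux ⊕ ds ⊕ cb ⊕ be ⊕ ua ⊕ ae) refl

-- The first piece uses labels below T and the second labels from T on; they share only p and q.

record Inner (p q T v : ℕ) : Set where
  constructor inner
  field
    v<T : v < T
    v≢p : v ≢ p
    v≢q : v ≢ q

data Near (p q T v : ℕ) : Set where
  at-p : v ≡ p → Near p q T v
  at-q : v ≡ q → Near p q T v
  inside : Inner p q T v → Near p q T v

data Far (p q T v : ℕ) : Set where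
  at-p : v ≡ p → Far p q T v
  at-q : v ≡ q → Far p q T v
  outside : T ≤ v → Far p q T v

EdgeBelow : ℕ → Edge → Set
EdgeBelow T e = proj₁ e < T × proj₂ e < T

NearEdge FarEdge InnerEdge OuterEdge : (p q T : ℕ) → Edge → Set
NearEdge p q T e = Near p q T (proj₁ e) × Near p q T (proj₂ e)
FarEdge p q T e = Far p q T (proj₁ e) × Far p q T (proj₂ e)
InnerEdge p q T e = Inner p q T (proj₁ e) ⊎ Inner p q T (proj₂ e)
OuterEdge p q T e = T ≤ proj₁ e ⊎ T ≤ proj₂ e

module Interface (p q T : ℕ) (p≢q : p ≢ q) (p<T : p < T) (q<T : q < T) where
  open PairConstraints p q p≢q

  near-view : ∀ {v} → v < T → Near p q T v
  near-view {v} v<T with v ≟ p | v ≟ q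
  ... | yes v≡p | _ = at-p v≡p
  ... | no _ | yes v≡q = at-q v≡q
  ... | no v≢p | no v≢q = inside (inner v<T v≢p v≢q)

  near-edge : ∀ {e} → EdgeBelow T e → NearEdge p q T e
  near-edge (a<T , b<T) = near-view a<T , near-view b<T

  far≢inner : ∀ {v z} → Inner p q T v → Far p q T z → z ≢ v
  far≢inner (inner v<T v≢p v≢q) (at-p refl) = v≢p ∘ sym
  far≢inner (inner v<T v≢p v≢q) (at-q refl) = v≢q ∘ sym
  far≢inner (inner v<T v≢p v≢q) (outside T≤z) refl = <⇒≱ v<T T≤z

  near≢outer : ∀ {v z} → T ≤ v → Near p q T z → z ≢ v
  near≢outer T≤v (at-p refl) refl = <⇒≱ p<T T≤v
  near≢outer T≤v (at-q refl) refl = <⇒≱ q<T T≤v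
  near≢outer T≤v (inside (inner z<T _ _)) refl = <⇒≱ z<T T≤v

  far-misses : ∀ {M v} → All (FarEdge p q T) M → Inner p q T v → All (Misses v) M
  far-misses far i = All.map (λ (fa , fb) → far≢inner i fa , far≢inner i fb) far

  near-misses : ∀ {M v} → All (NearEdge p q T) M → T ≤ v → All (Misses v) M
  near-misses near T≤v = All.map (λ (na , nb) → near≢outer T≤v na , near≢outer T≤v nb) near

  covers-inner : ∀ {M v} → All (FarEdge p q T) M → Inner p q T v → covers M v ≡ false
  covers-inner far i = covers-miss (far-misses far i)

  covers-outer : ∀ {M v} → All (NearEdge p q T) M → T ≤ v → covers M v ≡ false
  covers-outer near T≤v = covers-miss (near-misses near T≤v)

  ∈ᵇ-inner : ∀ {X v} → All (Inner p q T) X → Far p q T v → v ∈ᵇ X ≡ false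
  ∈ᵇ-inner inners f = ∈ᵇ-miss (All.map (λ i → ≢-sym (far≢inner i f)) inners)

  hasEdge-inner : ∀ {M e} → All (FarEdge p q T) M → InnerEdge p q T e → hasEdge M e ≡ false
  hasEdge-inner {e = u , v} far (inj₁ i) = hasEdge-miss₁ {u = u} {v} (far-misses far i)
  hasEdge-inner {e = u , v} far (inj₂ i) = hasEdge-miss₂ {u = u} {v} (far-misses far i)

  hasEdge-outer : ∀ {M e} → All (NearEdge p q T) M → OuterEdge p q T e → hasEdge M e ≡ false
  hasEdge-outer {e = u , v} near (inj₁ T≤u) = hasEdge-miss₁ {u = u} {v} (near-misses near T≤u)
  hasEdge-outer {e = u , v} near (inj₂ T≤v) = hasEdge-miss₂ {u = u} {v} (near-misses near T≤v)

  module Combine {M₁ M₂ : List Edge} (near : All (NearEdge p q T) M₁) (far : All (FarEdge p q T) M₂) where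
    c₁p c₁q c₂p c₂q : Bool
    c₁p = covers M₁ p
    c₁q = covers M₁ q
    c₂p = covers M₂ p
    c₂q = covers M₂ q

    covers-far-near : ∀ {a} → Near p q T a → covers M₂ a ≡ ((a ≡ᵇ p) ∧ c₂p) ∨ ((a ≡ᵇ q) ∧ c₂q)
    covers-far-near (at-p refl) =
      sym (trans (cong₂ (λ x y → (x ∧ c₂p) ∨ (y ∧ c₂q)) (≡ᵇ-refl p) (≡ᵇ-false p≢q)) (∨-identityʳ c₂p))
    covers-far-near (at-q refl) =
      sym (cong₂ (λ x y → (x ∧ c₂p) ∨ (y ∧ c₂q)) (≡ᵇ-false (p≢q ∘ sym)) (≡ᵇ-refl q))
    covers-far-near (inside i@(inner _ v≢p v≢q)) =
      trans (covers-inner far i) (sym (cong₂ (λ x y → (x ∧ c₂p) ∨ (y ∧ c₂q)) (≡ᵇ-false v≢p) (≡ᵇ-false v≢q)))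

    clash-interface : clash M₁ M₂ ≡ (c₁p ∧ c₂p) ∨ (c₁q ∧ c₂q)
    clash-interface = trans (all-near near) (any-∧-∨ (λ e → incident e p) (λ e → incident e q) c₂p c₂q M₁)
      where
      clash-edge : ∀ {e} → NearEdge p q T e → any (sharesVertex e) M₂ ≡ (incident e p ∧ c₂p) ∨ (incident e q ∧ c₂q)
      clash-edge {a , b} (na , nb) =
        trans (any-∨ (λ m → incident m a) (λ m → incident m b) M₂)
              (trans (cong₂ _∨_ (covers-far-near na) (covers-far-near nb)) (∨-∧-factor (a ≡ᵇ p) (a ≡ᵇ q) (b ≡ᵇ p) (b ≡ᵇ q) c₂p c₂q))
      all-near : ∀ {N} → All (NearEdge p q T) N →
                 any (λ e → any (sharesVertex e) M₂) N ≡ any (λ e → (incident e p ∧ c₂p) ∨ (incident e q ∧ c₂q)) N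
      all-near [] = refl
      all-near (ne ∷ nes) = cong₂ _∨_ (clash-edge ne) (all-near nes)

    isMatching-interface : isMatching (M₁ ++ M₂) ≡ (isMatching M₁ ∧ isMatching M₂) ∧ (not (c₁p ∧ c₂p) ∧ not (c₁q ∧ c₂q))
    isMatching-interface =
      trans (isMatching-++ M₁ M₂) (cong ((isMatching M₁ ∧ isMatching M₂) ∧_) (trans (cong not clash-interface) (not-∨ (c₁p ∧ c₂p) (c₁q ∧ c₂q))))

    coveredBy-near : ∀ {X a} → All (Inner p q T) X → Near p q T a →
                     coveredBy (M₁ ++ M₂) X a ≡ coveredBy M₁ (consIf c₂p p (consIf c₂q q X)) a
    coveredBy-near {X} inn (at-p refl) = begin
      covers (M₁ ++ M₂) p ∨ p ∈ᵇ X                  ≡⟨ cong₂ _∨_ (covers-++ M₁ M₂ p) (∈ᵇ-inner inn (at-p refl)) ⟩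
      (c₁p ∨ c₂p) ∨ false                           ≡⟨ ∨-identityʳ _ ⟩
      c₁p ∨ c₂p                                     ≡⟨ cong (c₁p ∨_) (sym (∈ᵇ-consIf-p c₂p c₂q X (∈ᵇ-inner inn (at-p refl)))) ⟩
      c₁p ∨ p ∈ᵇ consIf c₂p p (consIf c₂q q X)      ∎
      where open ≡-Reasoning
    coveredBy-near {X} inn (at-q refl) = begin
      covers (M₁ ++ M₂) q ∨ q ∈ᵇ X                  ≡⟨ cong₂ _∨_ (covers-++ M₁ M₂ q) (∈ᵇ-inner inn (at-q refl)) ⟩
      (c₁q ∨ c₂q) ∨ false                           ≡⟨ ∨-identityʳ _ ⟩
      c₁q ∨ c₂q                                     ≡⟨ cong (c₁q ∨_) (sym (∈ᵇ-consIf-q c₂p c₂q X (∈ᵇ-inner inn (at-q refl)))) ⟩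
      c₁q ∨ q ∈ᵇ consIf c₂p p (consIf c₂q q X)      ∎
      where open ≡-Reasoning
    coveredBy-near {X} {a} inn (inside i@(inner _ a≢p a≢q)) = begin
      covers (M₁ ++ M₂) a ∨ a ∈ᵇ X                  ≡⟨ cong (_∨ a ∈ᵇ X) (covers-++ M₁ M₂ a) ⟩
      (covers M₁ a ∨ covers M₂ a) ∨ a ∈ᵇ X          ≡⟨ cong (λ z → (covers M₁ a ∨ z) ∨ a ∈ᵇ X) (covers-inner far i) ⟩
      (covers M₁ a ∨ false) ∨ a ∈ᵇ X                ≡⟨ cong₂ _∨_ (∨-identityʳ _) (sym (∈ᵇ-consIf-other c₂p c₂q X a≢p a≢q)) ⟩
      covers M₁ a ∨ a ∈ᵇ consIf c₂p p (consIf c₂q q X) ∎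
      where open ≡-Reasoning

    coveredBy-far : ∀ {X z} → All (Inner p q T) X → Far p q T z →
                    coveredBy (M₁ ++ M₂) X z ≡ coveredBy M₂ (consIf c₁p p (consIf c₁q q [])) z
    coveredBy-far inn (at-p refl) = begin
      covers (M₁ ++ M₂) p ∨ _                       ≡⟨ cong₂ _∨_ (covers-++ M₁ M₂ p) (∈ᵇ-inner inn (at-p refl)) ⟩
      (c₁p ∨ c₂p) ∨ false                           ≡⟨ trans (∨-identityʳ _) (∨-comm c₁p c₂p) ⟩
      c₂p ∨ c₁p                                     ≡⟨ cong (c₂p ∨_) (sym (∈ᵇ-consIf-p c₁p c₁q [] refl)) ⟩
      c₂p ∨ p ∈ᵇ consIf c₁p p (consIf c₁q q [])     ∎
      where open ≡-Reasoning
    coveredBy-far inn (at-q refl) = begin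
      covers (M₁ ++ M₂) q ∨ _                       ≡⟨ cong₂ _∨_ (covers-++ M₁ M₂ q) (∈ᵇ-inner inn (at-q refl)) ⟩
      (c₁q ∨ c₂q) ∨ false                           ≡⟨ trans (∨-identityʳ _) (∨-comm c₁q c₂q) ⟩
      c₂q ∨ c₁q                                     ≡⟨ cong (c₂q ∨_) (sym (∈ᵇ-consIf-q c₁p c₁q [] refl)) ⟩
      c₂q ∨ q ∈ᵇ consIf c₁p p (consIf c₁q q [])     ∎
      where open ≡-Reasoning
    coveredBy-far {z = z} inn (outside T≤z) = begin
      covers (M₁ ++ M₂) z ∨ _                       ≡⟨ cong₂ _∨_ (covers-++ M₁ M₂ z) (∈ᵇ-inner inn (outside T≤z)) ⟩
      (covers M₁ z ∨ covers M₂ z) ∨ false           ≡⟨ trans (∨-identityʳ _) (cong (_∨ covers M₂ z) (covers-outer near T≤z)) ⟩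
      covers M₂ z                                   ≡⟨ sym (trans (cong (covers M₂ z ∨_) (∈ᵇ-consIf-other c₁p c₁q []
                                                            (near≢outer T≤z (at-p refl) ∘ sym) (near≢outer T≤z (at-q refl) ∘ sym)))
                                                          (∨-identityʳ _)) ⟩
      covers M₂ z ∨ z ∈ᵇ consIf c₁p p (consIf c₁q q []) ∎
      where open ≡-Reasoning

  -- Each side treats the interface vertices covered by the other side as externally covered (X), and
  -- must itself cover those it is responsible for (Bv).
  module _ (S₁ S₂ : List Edge) (X₁ Av₁ Bv₁ Bv₂ : List ℕ) (Ae₁ Be₁ Ae₂ Be₂ : List Edge)
           (S₁-below : All (EdgeBelow T) S₁) (S₂-far : All (FarEdge p q T) S₂)
           (X₁-inner : All (Inner p q T) X₁) (Av₁-inner : All (Inner p q T) Av₁)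
           (Bv₁-inner : All (Inner p q T) Bv₁) (Bv₂-far : All (Far p q T) Bv₂)
           (Ae₁-inner : All (InnerEdge p q T) Ae₁) (Be₁-inner : All (InnerEdge p q T) Be₁)
           (Ae₂-outer : All (OuterEdge p q T) Ae₂) (Be₂-outer : All (OuterEdge p q T) Be₂) where

    admissible : List Edge → Bool
    admissible = Admissible (S₁ ++ S₂) X₁ Av₁ (Ae₁ ++ Ae₂) (Bv₁ ++ Bv₂) (Be₁ ++ Be₂)

    admissible₁ admissible₂ : State → List Edge → Bool
    admissible₁ σ = Admissible S₁ (select by₂ σ p q X₁) (select exposed σ p q Av₁) Ae₁ (select by₁ σ p q Bv₁) Be₁
    admissible₂ σ = Admissible S₂ (select by₁ σ p q []) (select exposed σ p q []) Ae₂ (select by₂ σ p q Bv₂) Be₂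

    module _ {M₁ M₂ : List Edge} (near : All (NearEdge p q T) M₁) (far : All (FarEdge p q T) M₂) where
      open Combine near far

      R₁ R₂ : Bool → Bool → Bool
      R₁ = Residual S₁ X₁ Av₁ Ae₁ Bv₁ Be₁ M₁
      R₂ = Residual S₂ [] [] Ae₂ Bv₂ Be₂ M₂

      uncovered-inner : ∀ {v} → Inner p q T v → uncovered (M₁ ++ M₂) v ≡ uncovered M₁ v
      uncovered-inner {v} i = cong not (trans (covers-++ M₁ M₂ v) (trans (cong (covers M₁ v ∨_) (covers-inner far i)) (∨-identityʳ _)))

      hasEdge-inner-++ : ∀ {e} → InnerEdge p q T e → hasEdge (M₁ ++ M₂) e ≡ hasEdge M₁ e
      hasEdge-inner-++ {e} ie = trans (hasEdge-++ M₁ M₂ e) (trans (cong (hasEdge M₁ e ∨_) (hasEdge-inner far ie)) (∨-identityʳ _))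

      hasEdge-outer-++ : ∀ {e} → OuterEdge p q T e → hasEdge (M₁ ++ M₂) e ≡ hasEdge M₂ e
      hasEdge-outer-++ {e} oe = trans (hasEdge-++ M₁ M₂ e) (cong (_∨ hasEdge M₂ e) (hasEdge-outer near oe))

      admissible-++ : admissible (M₁ ++ M₂) ≡ (not (c₁p ∧ c₂p) ∧ not (c₁q ∧ c₂q)) ∧ (R₁ c₂p c₂q ∧ R₂ c₁p c₁q)
      admissible-++ = begin
        (isMatching M ∧ all (uncovered M) X₁ ∧ all (dominatedBy M X₁) (S₁ ++ S₂))
          ∧ all (coveredBy M X₁) (Bv₁ ++ Bv₂) ∧ all (hasEdge M) (Be₁ ++ Be₂) ∧ all (uncovered M) Av₁ ∧ all (not ∘ hasEdge M) (Ae₁ ++ Ae₂)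
          ≡⟨ cong₂ _∧_ (cong₂ _∧_ isMatching-interface (cong₂ _∧_ (all-cong uncovered-inner X₁-inner) dominated))
               (cong₂ _∧_ covered (cong₂ _∧_ has (cong₂ _∧_ (all-cong uncovered-inner Av₁-inner) hasNot))) ⟩
        (((I₁ ∧ I₂) ∧ (K₁ ∧ K₂)) ∧ UX ∧ (D₁ ∧ D₂)) ∧ (B₁ ∧ B₂) ∧ (E₁ ∧ E₂) ∧ UA ∧ (A₁ ∧ A₂)
          ≡⟨ shuffle I₁ I₂ K₁ K₂ UX D₁ D₂ B₁ B₂ E₁ E₂ UA A₁ A₂ ⟩
        (K₁ ∧ K₂) ∧ (I₁ ∧ UX ∧ D₁ ∧ B₁ ∧ E₁ ∧ UA ∧ A₁) ∧ (I₂ ∧ true ∧ D₂ ∧ B₂ ∧ E₂ ∧ true ∧ A₂) ∎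
        where
        open ≡-Reasoning
        open CMSolver ∧-commutativeMonoid
        M = M₁ ++ M₂
        X₁′ = consIf c₂p p (consIf c₂q q X₁)
        X₂′ = consIf c₁p p (consIf c₁q q [])
        I₁ = isMatching M₁
        I₂ = isMatching M₂
        K₁ = not (c₁p ∧ c₂p)
        K₂ = not (c₁q ∧ c₂q)
        UX = all (uncovered M₁) X₁
        D₁ = all (dominatedBy M₁ X₁′) S₁
        D₂ = all (dominatedBy M₂ X₂′) S₂
        B₁ = all (coveredBy M₁ X₁′) Bv₁
        B₂ = all (coveredBy M₂ X₂′) Bv₂
        E₁ = all (hasEdge M₁) Be₁
        E₂ = all (hasEdge M₂) Be₂
        UA = all (uncovered M₁) Av₁
        A₁ = all (not ∘ hasEdge M₁) Ae₁
        A₂ = all (not ∘ hasEdge M₂) Ae₂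
        dominated : all (dominatedBy M X₁) (S₁ ++ S₂) ≡ D₁ ∧ D₂
        dominated = trans (all-++ _ S₁ S₂) (cong₂ _∧_
          (all-cong (λ (a<T , b<T) → cong₂ _∨_ (coveredBy-near X₁-inner (near-view a<T)) (coveredBy-near X₁-inner (near-view b<T))) S₁-below)
          (all-cong (λ (fa , fb) → cong₂ _∨_ (coveredBy-far X₁-inner fa) (coveredBy-far X₁-inner fb)) S₂-far))
        covered : all (coveredBy M X₁) (Bv₁ ++ Bv₂) ≡ B₁ ∧ B₂
        covered = trans (all-++ _ Bv₁ Bv₂) (cong₂ _∧_
          (all-cong (λ i → coveredBy-near X₁-inner (inside i)) Bv₁-inner)
          (all-cong (coveredBy-far X₁-inner) Bv₂-far))
        has : all (hasEdge M) (Be₁ ++ Be₂) ≡ E₁ ∧ E₂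
        has = trans (all-++ _ Be₁ Be₂) (cong₂ _∧_ (all-cong hasEdge-inner-++ Be₁-inner) (all-cong hasEdge-outer-++ Be₂-outer))
        hasNot : all (not ∘ hasEdge M) (Ae₁ ++ Ae₂) ≡ A₁ ∧ A₂
        hasNot = trans (all-++ _ Ae₁ Ae₂) (cong₂ _∧_
          (all-cong (cong not ∘ hasEdge-inner-++) Ae₁-inner) (all-cong (cong not ∘ hasEdge-outer-++) Ae₂-outer))
        shuffle : ∀ i₁ i₂ k₁ k₂ ux d₁ d₂ b₁ b₂ e₁ e₂ ua a₁ a₂ →
          (((i₁ ∧ i₂) ∧ (k₁ ∧ k₂)) ∧ ux ∧ (d₁ ∧ d₂)) ∧ (b₁ ∧ b₂) ∧ (e₁ ∧ e₂) ∧ ua ∧ (a₁ ∧ a₂)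
          ≡ (k₁ ∧ k₂) ∧ (i₁ ∧ ux ∧ d₁ ∧ b₁ ∧ e₁ ∧ ua ∧ a₁) ∧ (i₂ ∧ true ∧ d₂ ∧ b₂ ∧ e₂ ∧ true ∧ a₂)
        shuffle = solve 14 (λ i₁ i₂ k₁ k₂ ux d₁ d₂ b₁ b₂ e₁ e₂ ua a₁ a₂ →
          (((i₁ ⊕ i₂) ⊕ (k₁ ⊕ k₂)) ⊕ ux ⊕ (d₁ ⊕ d₂)) ⊕ (b₁ ⊕ b₂) ⊕ (e₁ ⊕ e₂) ⊕ ua ⊕ (a₁ ⊕ a₂)
          ⊜ (k₁ ⊕ k₂) ⊕ (i₁ ⊕ ux ⊕ d₁ ⊕ b₁ ⊕ e₁ ⊕ ua ⊕ a₁) ⊕ (i₂ ⊕ id ⊕ d₂ ⊕ b₂ ⊕ e₂ ⊕ id ⊕ a₂)) refl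

      admissible-state : ∀ σ → toℕ (admissible₁ σ M₁) * toℕ (admissible₂ σ M₂)
        ≡ toℕ ((fits₁ σ c₁p c₁q ∧ fits₂ σ c₂p c₂q)
               ∧ (R₁ (proj₁ σ == by₂) (proj₂ σ == by₂) ∧ R₂ (proj₁ σ == by₁) (proj₂ σ == by₁)))
      admissible-state (s , t) =
        trans (sym (toℕ-∧ (admissible₁ (s , t) M₁) (admissible₂ (s , t) M₂)))
          (cong toℕ (trans (cong₂ _∧_
              (Admissible-consIf S₁ X₁ Av₁ Ae₁ Bv₁ Be₁ M₁ (s == exposed) (t == exposed) (s == by₁) (t == by₁) (s == by₂) (t == by₂)
                 (∈ᵇ-inner X₁-inner (at-p refl)) (∈ᵇ-inner X₁-inner (at-q refl)))
              (Admissible-consIf S₂ [] [] Ae₂ Bv₂ Be₂ M₂ (s == exposed) (t == exposed) (s == by₂) (t == by₂) (s == by₁) (t == by₁)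
                 refl refl))
            (interchange (fits₁ (s , t) c₁p c₁q) (R₁ (s == by₂) (t == by₂)) (fits₂ (s , t) c₂p c₂q) (R₂ (s == by₁) (t == by₁)))))
        where
        open CMSolver ∧-commutativeMonoid
        interchange : ∀ a b c d → (a ∧ b) ∧ (c ∧ d) ≡ (a ∧ c) ∧ (b ∧ d)
        interchange = solve 4 (λ a b c d → (a ⊕ b) ⊕ (c ⊕ d) ⊜ (a ⊕ c) ⊕ (b ⊕ d)) refl

      admissible-factor : toℕ (admissible (M₁ ++ M₂)) ≡ ∑[ σ ∈ states ] (toℕ (admissible₁ σ M₁) * toℕ (admissible₂ σ M₂))
      admissible-factor =
        trans (cong toℕ admissible-++)
              (sym (trans (∑-ext admissible-state states) (states-collapse R₁ R₂ c₁p c₁q c₂p c₂q)))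

    Φ-split : Φ (S₁ ++ S₂) X₁ Av₁ (Ae₁ ++ Ae₂) (Bv₁ ++ Bv₂) (Be₁ ++ Be₂)
      ≡ ∑[ σ ∈ states ] (Φ S₁ (select by₂ σ p q X₁) (select exposed σ p q Av₁) Ae₁ (select by₁ σ p q Bv₁) Be₁
                        * Φ S₂ (select by₁ σ p q []) (select exposed σ p q []) Ae₂ (select by₂ σ p q Bv₂) Be₂)
    Φ-split = ∑-sublists-factor states S₁ S₂ (toℕ ∘ admissible) (λ σ → toℕ ∘ admissible₁ σ) (λ σ → toℕ ∘ admissible₂ σ)
                (All.map near-edge S₁-below) S₂-far admissible-factor

exitW exitU : ℕ → ℕ → ℕ → Turn → ℕ
exitW x y b t = lookup (hexPath x y b) (wPos t)
exitU x y b t = lookup (hexPath x y b) (uPos t)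

hexLabel : ℕ → ℕ → ℕ → ℕ → ℕ
hexLabel x y b zero = x
hexLabel x y b (suc zero) = y
hexLabel x y b (suc (suc k)) = k + b

below≢block : ∀ {v b} k → v < b → v ≢ k + b
below≢block {b = b} k v<b refl = <⇒≱ v<b (m≤n+m b k)

module _ {x y b : ℕ} (x<b : x < b) (y<b : y < b) where

  hexLabel-injective : x ≢ y → ∀ {i j} → hexLabel x y b i ≡ hexLabel x y b j → i ≡ j
  hexLabel-injective x≢y {zero} {zero} eq = refl
  hexLabel-injective x≢y {zero} {suc zero} eq = ⊥-elim (x≢y eq)
  hexLabel-injective x≢y {zero} {suc (suc l)} eq = ⊥-elim (below≢block l x<b eq)
  hexLabel-injective x≢y {suc zero} {zero} eq = ⊥-elim (x≢y (sym eq))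
  hexLabel-injective x≢y {suc zero} {suc zero} eq = refl
  hexLabel-injective x≢y {suc zero} {suc (suc l)} eq = ⊥-elim (below≢block l y<b eq)
  hexLabel-injective x≢y {suc (suc k)} {zero} eq = ⊥-elim (below≢block k x<b (sym eq))
  hexLabel-injective x≢y {suc (suc k)} {suc zero} eq = ⊥-elim (below≢block k y<b (sym eq))
  hexLabel-injective x≢y {suc (suc k)} {suc (suc l)} eq = cong (2 +_) (+-cancelʳ-≡ b k l eq)

below-inner : ∀ {v b p q T} → v < b → b ≤ p → b ≤ q → b ≤ T → Inner p q T v
below-inner v<b b≤p b≤q b≤T =
  inner (<-≤-trans v<b b≤T) (<⇒≢ (<-≤-trans v<b b≤p)) (<⇒≢ (<-≤-trans v<b b≤q))

block-inner : ∀ {b T} k i j {k<4 : True (k <? 4)} {k≢i : False (k ≟ i)} {k≢j : False (k ≟ j)} →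
              4 + b ≤ T → Inner (i + b) (j + b) T (k + b)
block-inner {b} k i j {k<4} {k≢i} {k≢j} 4+b≤T =
  inner (<-≤-trans (+-monoˡ-< b (toWitness k<4)) 4+b≤T)
        (toWitnessFalse k≢i ∘ +-cancelʳ-≡ b k i) (toWitnessFalse k≢j ∘ +-cancelʳ-≡ b k j)

record Exit (b w u : ℕ) : Set where
  field
    w≢u : w ≢ u
    w<4+b : w < 4 + b
    u<4+b : u < 4 + b
    b≤w : b ≤ w
    b≤u : b ≤ u

exit-block : ∀ b o → o < 3 → Exit b (suc o + b) (o + b)
exit-block b o o<3 = record
  { w≢u = 1+n≢n
  ; w<4+b = +-monoˡ-< b (s≤s o<3)
  ; u<4+b = +-monoˡ-< b (m≤n⇒m≤1+n o<3)
  ; b≤w = m≤n+m b (suc o)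
  ; b≤u = m≤n+m b o
  }

exit : ∀ x y b t → Exit b (exitW x y b t) (exitU x y b t)
exit x y b k1 = exit-block b 0 (s≤s z≤n)
exit x y b k2 = exit-block b 1 (s≤s (s≤s z≤n))
exit x y b k3 = exit-block b 2 (s≤s (s≤s (s≤s z≤n)))

hex-below : ∀ {x y b} → x < b → y < b → All (EdgeBelow (4 + b)) (hexEdges (hexPath x y b))
hex-below {x} {y} {b} x<b y<b =
  (y<4+b , block 0) ∷ (block 0 , block 1) ∷ (block 1 , block 2) ∷ (block 2 , block 3) ∷ (block 3 , x<4+b) ∷ []
  where
  block : ∀ k → {k<4 : True (k <? 4)} → k + b < 4 + b
  block k {k<4} = +-monoˡ-< b (toWitness k<4)
  x<4+b = <-≤-trans x<b (m≤n+m b 4)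
  y<4+b = <-≤-trans y<b (m≤n+m b 4)

far-weaken : ∀ {x y b w u v} → b ≤ w → b ≤ u → Far w u (4 + b) v → Far x y b v
far-weaken b≤w b≤u (at-p refl) = outside b≤w
far-weaken b≤w b≤u (at-q refl) = outside b≤u
far-weaken {b = b} b≤w b≤u (outside 4+b≤v) = outside (≤-trans (m≤n+m b 4) 4+b≤v)

far-shift : ∀ {p q T p′ q′ T′ v} → T ≤ p → T ≤ q → T ≤ T′ → Far p q T′ v → Far p′ q′ T v
far-shift T≤p T≤q T≤T′ (at-p refl) = outside T≤p
far-shift T≤p T≤q T≤T′ (at-q refl) = outside T≤q
far-shift T≤p T≤q T≤T′ (outside T′≤v) = outside (≤-trans T≤T′ T′≤v)

hex-far : ∀ x y b → All (FarEdge x y b) (hexEdges (hexPath x y b))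
hex-far x y b =
  (at-q refl , block 0) ∷ (block 0 , block 1) ∷ (block 1 , block 2) ∷ (block 2 , block 3) ∷ (block 3 , at-p refl) ∷ []
  where
  block : ∀ k → Far x y b (k + b)
  block k = outside (m≤n+m b k)

chain-far : ∀ x y b ts → All (FarEdge x y b) (chainEdges x y b ts)
chain-far x y b [] = []
chain-far x y b (t ∷ ts) =
  ++⁺ (hex-far x y b) (All.map (λ (fu , fv) → far-weaken b≤w b≤u fu , far-weaken b≤w b≤u fv)
                                (chain-far (exitW x y b t) (exitU x y b t) (4 + b) ts))
  where open Exit (exit x y b t)

closing-far : ∀ x y b t ts {e d c f} → edcfOf (lastHex x y b t ts) ≡ edcf e d c f → Far x y b f × b ≤ d × b ≤ c
closing-far x y b k1 [] refl = outside (m≤n+m b 2) , ≤-refl , n≤1+n b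
closing-far x y b k2 [] refl = outside (m≤n+m b 3) , n≤1+n b , m≤n+m b 2
closing-far x y b k3 [] refl = at-p refl , m≤n+m b 2 , m≤n+m b 3
closing-far x y b t (t′ ∷ ts) eq
  with far , 4+b≤d , 4+b≤c ← closing-far (exitW x y b t) (exitU x y b t) (4 + b) t′ ts eq =
  far-weaken b≤w b≤u far , ≤-trans (m≤n+m b 4) 4+b≤d , ≤-trans (m≤n+m b 4) 4+b≤c
  where open Exit (exit x y b t)

record ClosingHexagon (b N e d c f : ℕ) : Set where
  field
    dc-exit : Exit b c d
    e-inner : Inner d c N e
    f-inner : Inner d c N f

closing-hexagon : ∀ x y b t {N e d c f} → x < b → y < b → 4 + b ≤ N → edcfOf (hexPath x y b , t) ≡ edcf e d c f →
          ClosingHexagon b N e d c f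
closing-hexagon x y b k1 x<b y<b 4+b≤N refl =
  record { dc-exit = exit x y b k1 ; e-inner = below-inner y<b ≤-refl (n≤1+n b) b≤N ; f-inner = block-inner 2 0 1 4+b≤N }
  where b≤N = ≤-trans (m≤n+m b 4) 4+b≤N
closing-hexagon x y b k2 x<b y<b 4+b≤N refl =
  record { dc-exit = exit x y b k2 ; e-inner = block-inner 0 1 2 4+b≤N ; f-inner = block-inner 3 1 2 4+b≤N }
closing-hexagon x y b k3 x<b y<b 4+b≤N refl =
  record { dc-exit = exit x y b k3 ; e-inner = block-inner 1 2 3 4+b≤N ; f-inner = below-inner x<b (m≤n+m b 2) (m≤n+m b 3) b≤N }
  where b≤N = ≤-trans (m≤n+m b 4) 4+b≤N

-- Transfer tables of the standard hexagon

turns : List Turn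
turns = k1 ∷ k2 ∷ k3 ∷ []

∈-turns : ∀ t → t ∈ turns
∈-turns k1 = here refl
∈-turns k2 = there (here refl)
∈-turns k3 = there (there (here refl))

∈-states : ∀ σ → σ ∈ states
∈-states (by₁ , by₁) = here refl
∈-states (by₁ , by₂) = there (here refl)
∈-states (by₁ , exposed) = there (there (here refl))
∈-states (by₂ , by₁) = there (there (there (here refl)))
∈-states (by₂ , by₂) = there (there (there (there (here refl))))
∈-states (by₂ , exposed) = there (there (there (there (there (here refl)))))
∈-states (exposed , by₁) = there (there (there (there (there (there (here refl))))))
∈-states (exposed , by₂) = there (there (there (there (there (there (there (here refl)))))))
∈-states (exposed , exposed) = there (there (there (there (there (there (there (there (here refl))))))))

module _ {A B C : Set} {as : List A} {bs : List B} {cs : List C}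
         (∈as : ∀ a → a ∈ as) (∈bs : ∀ b → b ∈ bs) (∈cs : ∀ c → c ∈ cs) where

  by-exhaustion : {P : A → B → C → Set} (P? : ∀ a b c → Dec (P a b c)) →
    {_ : True (all? (λ a → all? (λ b → all? (P? a b) cs) bs) as)} → ∀ a b c → P a b c
  by-exhaustion P? {ok} a b c = All.lookup (All.lookup (All.lookup (toWitness ok) (∈as a)) (∈bs b)) (∈cs c)

H₀ : List Edge
H₀ = hexEdges (hexPath 0 1 2)

outW outU : Turn → ℕ
outW = exitW 0 1 2
outU = exitU 0 1 2

exit-hexLabel : ∀ x y b t → exitW x y b t ≡ hexLabel x y b (outW t) × exitU x y b t ≡ hexLabel x y b (outU t)
exit-hexLabel x y b k1 = refl , refl
exit-hexLabel x y b k2 = refl , refl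
exit-hexLabel x y b k3 = refl , refl

relabelEDCF : (ℕ → ℕ) → EDCF → EDCF
relabelEDCF φ r = edcf (φ (EDCF.ve r)) (φ (EDCF.vd r)) (φ (EDCF.vc r)) (φ (EDCF.vf r))

edcf-hexLabel : ∀ x y b t → edcfOf (hexPath x y b , t) ≡ relabelEDCF (hexLabel x y b) (edcfOf (hexPath 0 1 2 , t))
edcf-hexLabel x y b k1 = refl
edcf-hexLabel x y b k2 = refl
edcf-hexLabel x y b k3 = refl

deleted required : Fin 9 → List ℕ
deleted zero = []
deleted (suc zero) = 1 ∷ []
deleted (suc (suc zero)) = 0 ∷ []
deleted (suc (suc (suc zero))) = 1 ∷ 0 ∷ []
deleted (suc (suc (suc (suc zero)))) = []
deleted (suc (suc (suc (suc (suc zero))))) = 1 ∷ []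
deleted (suc (suc (suc (suc (suc (suc zero)))))) = 0 ∷ []
deleted (suc (suc (suc (suc (suc (suc (suc zero))))))) = []
deleted (suc (suc (suc (suc (suc (suc (suc (suc zero)))))))) = []
required zero = []
required (suc zero) = []
required (suc (suc zero)) = []
required (suc (suc (suc zero))) = []
required (suc (suc (suc (suc zero)))) = 1 ∷ 0 ∷ []
required (suc (suc (suc (suc (suc zero))))) = 0 ∷ []
required (suc (suc (suc (suc (suc (suc zero)))))) = 1 ∷ []
required (suc (suc (suc (suc (suc (suc (suc zero))))))) = 1 ∷ []
required (suc (suc (suc (suc (suc (suc (suc (suc zero)))))))) = 0 ∷ []

1<2 : 1 < 2
1<2 = s≤s (s≤s z≤n)

0<2 : 0 < 2
0<2 = s≤s z≤n

deleted-<2 : ∀ i → All (_< 2) (deleted i)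
deleted-<2 zero = []
deleted-<2 (suc zero) = 1<2 ∷ []
deleted-<2 (suc (suc zero)) = 0<2 ∷ []
deleted-<2 (suc (suc (suc zero))) = 1<2 ∷ 0<2 ∷ []
deleted-<2 (suc (suc (suc (suc zero)))) = []
deleted-<2 (suc (suc (suc (suc (suc zero))))) = 1<2 ∷ []
deleted-<2 (suc (suc (suc (suc (suc (suc zero)))))) = 0<2 ∷ []
deleted-<2 (suc (suc (suc (suc (suc (suc (suc zero))))))) = []
deleted-<2 (suc (suc (suc (suc (suc (suc (suc (suc zero)))))))) = []

required-<2 : ∀ i → All (_< 2) (required i)
required-<2 zero = []
required-<2 (suc zero) = []
required-<2 (suc (suc zero)) = []
required-<2 (suc (suc (suc zero))) = []
required-<2 (suc (suc (suc (suc zero)))) = 1<2 ∷ 0<2 ∷ []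
required-<2 (suc (suc (suc (suc (suc zero))))) = 0<2 ∷ []
required-<2 (suc (suc (suc (suc (suc (suc zero)))))) = 1<2 ∷ []
required-<2 (suc (suc (suc (suc (suc (suc (suc zero))))))) = 1<2 ∷ []
required-<2 (suc (suc (suc (suc (suc (suc (suc (suc zero)))))))) = 0<2 ∷ []

Σ₉ : (Fin 9 → ℕ) → ℕ
Σ₉ f = ∑[ m ∈ allFin 9 ] f m

firstTable : Turn → Fin 9 → State → ℕ
firstTable t i σ = Φ S (select by₂ σ (outW t) (outU t) []) (select exposed σ (outW t) (outU t) []) []
                       (select by₁ σ (outW t) (outU t) (required i)) []
  where S = edgesMinus ((1 , 0) ∷ H₀) (deleted i)

-- Row m lists the states of an interface edge (x, y) through which component m of Ψ_yx decomposes when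
-- the edge is regarded as a one-edge piece before the interface; a deleted vertex counts as covered by
-- that piece.

basis : Fin 9 → State → ℕ
basis i σ = fromRows rows i (index σ)
  where
  index : State → Fin 9
  index (by₁ , by₁) = zero
  index (by₁ , by₂) = suc zero
  index (by₁ , exposed) = suc (suc zero)
  index (by₂ , by₁) = suc (suc (suc zero))
  index (by₂ , by₂) = suc (suc (suc (suc zero)))
  index (by₂ , exposed) = suc (suc (suc (suc (suc zero))))
  index (exposed , by₁) = suc (suc (suc (suc (suc (suc zero)))))
  index (exposed , by₂) = suc (suc (suc (suc (suc (suc (suc zero))))))
  index (exposed , exposed) = suc (suc (suc (suc (suc (suc (suc (suc zero)))))))
  rows : Vec (Vec ℕ 9) 9
  rows = (1 ∷ 0 ∷ 0 ∷ 0 ∷ 1 ∷ 1 ∷ 0 ∷ 1 ∷ 0 ∷ [])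
       ∷ (0 ∷ 0 ∷ 0 ∷ 1 ∷ 0 ∷ 0 ∷ 1 ∷ 0 ∷ 0 ∷ [])
       ∷ (0 ∷ 1 ∷ 1 ∷ 0 ∷ 0 ∷ 0 ∷ 0 ∷ 0 ∷ 0 ∷ [])
       ∷ (1 ∷ 0 ∷ 0 ∷ 0 ∷ 0 ∷ 0 ∷ 0 ∷ 0 ∷ 0 ∷ [])
       ∷ (1 ∷ 0 ∷ 0 ∷ 0 ∷ 1 ∷ 0 ∷ 0 ∷ 0 ∷ 0 ∷ [])
       ∷ (0 ∷ 0 ∷ 0 ∷ 1 ∷ 0 ∷ 0 ∷ 0 ∷ 0 ∷ 0 ∷ [])
       ∷ (0 ∷ 1 ∷ 0 ∷ 0 ∷ 0 ∷ 0 ∷ 0 ∷ 0 ∷ 0 ∷ [])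
       ∷ (1 ∷ 0 ∷ 0 ∷ 0 ∷ 1 ∷ 0 ∷ 0 ∷ 1 ∷ 0 ∷ [])
       ∷ (1 ∷ 0 ∷ 0 ∷ 0 ∷ 1 ∷ 1 ∷ 0 ∷ 0 ∷ 0 ∷ [])
       ∷ []

-- A hexagon between its entry (x, y), in state α, and its exit (p, q), in state β; in each state by₁
-- refers to the piece before the interface and by₂ to the piece after it.

hexagonCount : (H : List Edge) (x y : ℕ) (α : State) (p q : ℕ) (β : State) (Ae : List Edge) (B : List ℕ) (Be : List Edge) → ℕ
hexagonCount H x y α p q β Ae B Be =
  Φ H (select by₂ β p q (select by₁ α x y [])) (select exposed β p q (select exposed α x y [])) Ae
      (select by₁ β p q (select by₂ α x y B)) Be

transferTable closingTable : Turn → State → State → ℕ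
transferTable t α β = hexagonCount H₀ 0 1 α (outW t) (outU t) β [] [] []
closingTable t α γ = hexagonCount H₀ 0 1 α d c γ ((f , c) ∷ []) (f ∷ []) ((e , d) ∷ [])
  where open EDCF (edcfOf (hexPath 0 1 2 , t)) renaming (ve to e; vd to d; vc to c; vf to f)

-- The (d, c)-states compatible with ed ∈ M and fc ∉ M: d is covered by the hexagon, c is not.

closingWeight : State → ℕ
closingWeight (by₁ , by₂) = 1
closingWeight (by₁ , exposed) = 1
closingWeight _ = 0

first-table : ∀ t i σ → firstTable t i σ ≡ Σ₉ (λ m → fM t i m * basis m σ)
first-table = by-exhaustion ∈-turns ∈-allFin ∈-states (λ t i σ → firstTable t i σ ≟ Σ₉ (λ m → fM t i m * basis m σ))

transfer-table : ∀ t k β → ∑[ α ∈ states ] (basis k α * transferTable t α β) ≡ Σ₉ (λ m → fM t k m * basis m β)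
transfer-table = by-exhaustion ∈-turns ∈-allFin ∈-states
  (λ t k β → ∑[ α ∈ states ] (basis k α * transferTable t α β) ≟ Σ₉ (λ m → fM t k m * basis m β))

closing-table : ∀ t k γ → ∑[ α ∈ states ] (basis k α * closingTable t α γ) ≡ fM t k (suc zero) * closingWeight γ
closing-table = by-exhaustion ∈-turns ∈-allFin ∈-states
  (λ t k γ → ∑[ α ∈ states ] (basis k α * closingTable t α γ) ≟ fM t k (suc zero) * closingWeight γ)

module _ {x y b : ℕ} (x<b : x < b) (y<b : y < b) (x≢y : x ≢ y) where
  open Relabel (hexLabel x y b) (hexLabel-injective x<b y<b x≢y)

  hexagonCount-relabel : ∀ α p q β Ae B Be →
    hexagonCount (hexEdges (hexPath x y b)) x y α (hexLabel x y b p) (hexLabel x y b q) β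
                 (map (mapEdge (hexLabel x y b)) Ae) (map (hexLabel x y b) B) (map (mapEdge (hexLabel x y b)) Be)
    ≡ hexagonCount H₀ 0 1 α p q β Ae B Be
  hexagonCount-relabel α p q β Ae B Be =
    trans (Φ-cong {S = hexEdges (hexPath x y b)} {map (mapEdge φ) Ae} {map (mapEdge φ) Be} (nested by₂ by₁ []) (nested exposed exposed []) (nested by₁ by₂ B))
          (Φ-relabel H₀ (select by₂ β p q (select by₁ α 0 1 [])) (select exposed β p q (select exposed α 0 1 [])) Ae
                        (select by₁ β p q (select by₂ α 0 1 B)) Be)
    where
    φ = hexLabel x y b
    nested : ∀ c c′ R → select c β (φ p) (φ q) (select c′ α x y (map φ R)) ≡ map φ (select c β p q (select c′ α 0 1 R))
    nested c c′ R = sym (trans (map-select φ c β p q _) (cong (select c β (φ p) (φ q)) (map-select φ c′ α 0 1 R)))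

dc-incident : ∀ p q r s → (p ∧ q) ∨ (r ∧ s) ≡ true → p ∨ s ≡ true
dc-incident true q r s _ = refl
dc-incident false q r true _ = refl
dc-incident false q true false ()
dc-incident false q false false ()

module Attachment (N d c dK cK : ℕ) (EK : List Edge) where

  ρ : ℕ → ℕ
  ρ = relabelK N d c dK cK

  Kr : List Edge
  Kr = glue [] N d c EK dK cK

  Kvec : State → ℕ
  Kvec γ = Φ Kr (select by₁ γ d c []) (select exposed γ d c []) [] (select by₂ γ d c []) []

  ρ-cases : ∀ v → (v ≡ dK × ρ v ≡ d) ⊎ (v ≡ cK × ρ v ≡ c) ⊎ ρ v ≡ N + v
  ρ-cases v with v ≡ᵇ dK in v≡dK
  ... | true = inj₁ (≡ᵇ-true v≡dK , refl)
  ... | false with v ≡ᵇ cK in v≡cK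
  ...   | true = inj₂ (inj₁ (≡ᵇ-true v≡cK , refl))
  ...   | false = inj₂ (inj₂ refl)

  ρ-far : ∀ v → Far d c N (ρ v)
  ρ-far v with ρ-cases v
  ... | inj₁ (_ , eq) = at-p eq
  ... | inj₂ (inj₁ (_ , eq)) = at-q eq
  ... | inj₂ (inj₂ eq) = outside (subst (N ≤_) (sym eq) (m≤m+n N v))

  Kr-far : All (FarEdge d c N) Kr
  Kr-far = map⁺ (All.universal (λ e → ρ-far (proj₁ e) , ρ-far (proj₂ e)) _)

  edgesMinus-without-dc : ∀ L → edgesMinus (filter (λ e → T? (not (sameEdgeᵇ e (dK , cK)))) L) (dK ∷ []) ≡ edgesMinus L (dK ∷ [])
  edgesMinus-without-dc [] = refl
  edgesMinus-without-dc ((a , b) ∷ L) with sameEdgeᵇ (a , b) (dK , cK) in is-dc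
  ... | false with not (incident (a , b) dK ∨ false)
  ...   | true = cong ((a , b) ∷_) (edgesMinus-without-dc L)
  ...   | false = edgesMinus-without-dc L
  edgesMinus-without-dc ((a , b) ∷ L) | true rewrite dc-incident (a ≡ᵇ dK) (b ≡ᵇ cK) (a ≡ᵇ cK) (b ≡ᵇ dK) is-dc =
    edgesMinus-without-dc L

  module _ (d≢c : d ≢ c) (d<N : d < N) (c<N : c < N) where

    ρ-injective : ∀ {a b} → ρ a ≡ ρ b → a ≡ b
    ρ-injective {a} {b} eq with ρ-cases a | ρ-cases b
    ... | inj₁ (a≡dK , _) | inj₁ (b≡dK , _) = trans a≡dK (sym b≡dK)
    ... | inj₁ (_ , ρa) | inj₂ (inj₁ (_ , ρb)) = ⊥-elim (d≢c (trans (sym ρa) (trans eq ρb)))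
    ... | inj₁ (_ , ρa) | inj₂ (inj₂ ρb) = ⊥-elim (<⇒≱ d<N (subst (N ≤_) (trans (sym ρb) (trans (sym eq) ρa)) (m≤m+n N b)))
    ... | inj₂ (inj₁ (_ , ρa)) | inj₁ (_ , ρb) = ⊥-elim (d≢c (trans (sym ρb) (trans (sym eq) ρa)))
    ... | inj₂ (inj₁ (a≡cK , _)) | inj₂ (inj₁ (b≡cK , _)) = trans a≡cK (sym b≡cK)
    ... | inj₂ (inj₁ (_ , ρa)) | inj₂ (inj₂ ρb) = ⊥-elim (<⇒≱ c<N (subst (N ≤_) (trans (sym ρb) (trans (sym eq) ρa)) (m≤m+n N b)))
    ... | inj₂ (inj₂ ρa) | inj₁ (_ , ρb) = ⊥-elim (<⇒≱ d<N (subst (N ≤_) (trans (sym ρa) (trans eq ρb)) (m≤m+n N a)))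
    ... | inj₂ (inj₂ ρa) | inj₂ (inj₁ (_ , ρb)) = ⊥-elim (<⇒≱ c<N (subst (N ≤_) (trans (sym ρa) (trans eq ρb)) (m≤m+n N a)))
    ... | inj₂ (inj₂ ρa) | inj₂ (inj₂ ρb) = +-cancelˡ-≡ N a b (trans (sym ρa) (trans eq ρb))

    open Relabel ρ ρ-injective

    Kvec-closing : Kvec (by₁ , by₂) + Kvec (by₁ , exposed) ≡ Ψ EK (dK ∷ []) [] [] [] []
    Kvec-closing = begin
      Φ Kr (d ∷ []) [] [] (c ∷ []) [] + Φ Kr (d ∷ []) (c ∷ []) [] [] []
        ≡⟨ Φ-covered+uncovered Kr (d ∷ []) [] [] [] [] c (trans (∨-identityʳ (c ≡ᵇ d)) (≡ᵇ-false (d≢c ∘ sym))) ⟩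
      Φ Kr (d ∷ []) [] [] [] []
        ≡⟨ Φ-external≡delete Kr d ⟩
      Φ (edgesMinus Kr (d ∷ [])) [] [] [] [] []
        ≡⟨ cong (λ D → Φ (edgesMinus Kr D) [] [] [] [] []) (cong (_∷ []) (sym ρdK)) ⟩
      Φ (edgesMinus (map (mapEdge ρ) K′) (map ρ (dK ∷ []))) [] [] [] [] []
        ≡⟨ cong (λ S → Φ S [] [] [] [] []) (trans (edgesMinus-relabel K′ (dK ∷ [])) (cong (map (mapEdge ρ)) (edgesMinus-without-dc EK))) ⟩
      Φ (map (mapEdge ρ) (edgesMinus EK (dK ∷ []))) [] [] [] [] []
        ≡⟨ Φ-relabel (edgesMinus EK (dK ∷ [])) [] [] [] [] [] ⟩
      Φ (edgesMinus EK (dK ∷ [])) [] [] [] [] []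
        ≡⟨ sym (Ψ≡Φ EK (dK ∷ []) [] [] [] []) ⟩
      Ψ EK (dK ∷ []) [] [] [] [] ∎
      where
      open ≡-Reasoning
      K′ = filter (λ e → T? (not (sameEdgeᵇ e (dK , cK)))) EK
      ρdK : ρ dK ≡ d
      ρdK rewrite ≡ᵇ-refl dK = refl

-- The chain recursion

select-++ : ∀ c σ p q L → select c σ p q [] ++ L ≡ select c σ p q L
select-++ c (s , t) p q L with s == c | t == c
... | true | true = refl
... | true | false = refl
... | false | true = refl
... | false | false = refl

All-select : ∀ {P : ℕ → Set} c σ {p q R} → P p → P q → All P R → All P (select c σ p q R)
All-select c (s , t) pp pq pR with s == c | t == c
... | true | true = pp ∷ pq ∷ pR
... | true | false = pp ∷ pR
... | false | true = pq ∷ pR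
... | false | false = pR

factor-through-basis : (X V : State → ℕ) (F R : Fin 9 → ℕ) (ψ : ℕ) →
  (∀ β → X β ≡ Σ₉ (λ m → F m * basis m β)) → (∀ m → ∑[ β ∈ states ] (basis m β * V β) ≡ R m * ψ) →
  ∑[ β ∈ states ] (X β * V β) ≡ Σ₉ (λ m → F m * R m) * ψ
factor-through-basis X V F R ψ X≡ V≡ = begin
  ∑[ β ∈ states ] (X β * V β)                                  ≡⟨ ∑-ext (λ β → cong (_* V β) (X≡ β)) states ⟩
  ∑[ β ∈ states ] (Σ₉ (λ m → F m * basis m β) * V β)           ≡⟨ sym (∑-*-∑ (allFin 9) states F basis V) ⟩
  Σ₉ (λ m → F m * ∑[ β ∈ states ] (basis m β * V β))           ≡⟨ ∑-ext (λ m → cong (F m *_) (V≡ m)) (allFin 9) ⟩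
  Σ₉ (λ m → F m * (R m * ψ))                                   ≡⟨ ∑-ext (λ m → sym (*-assoc (F m) (R m) ψ)) (allFin 9) ⟩
  Σ₉ (λ m → F m * R m * ψ)                                     ≡⟨ ∑-*ʳ ψ (allFin 9) (λ m → F m * R m) ⟩
  Σ₉ (λ m → F m * R m) * ψ                                     ∎
  where open ≡-Reasoning

column₁-identityʳ : ∀ (A : Mat) k → (A ⊗ I₉) k (suc zero) ≡ A k (suc zero)
column₁-identityʳ A k = shape (A k zero) (A k (suc zero)) (A k (suc (suc zero))) (A k (suc (suc (suc zero))))
  (A k (suc (suc (suc (suc zero))))) (A k (suc (suc (suc (suc (suc zero))))))
  (A k (suc (suc (suc (suc (suc (suc zero))))))) (A k (suc (suc (suc (suc (suc (suc (suc zero))))))))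
  (A k (suc (suc (suc (suc (suc (suc (suc (suc zero)))))))))
  where
  shape : ∀ a₀ a₁ a₂ a₃ a₄ a₅ a₆ a₇ a₈ →
    a₀ * 0 + (a₁ * 1 + (a₂ * 0 + (a₃ * 0 + (a₄ * 0 + (a₅ * 0 + (a₆ * 0 + (a₇ * 0 + (a₈ * 0 + 0)))))))) ≡ a₁
  shape = solve-∀

closingWeight-∑ : ∀ w (V : State → ℕ) → ∑[ γ ∈ states ] (w * closingWeight γ * V γ) ≡ w * (V (by₁ , by₂) + V (by₁ , exposed))
closingWeight-∑ w V = shape w (V (by₁ , by₁)) (V (by₁ , by₂)) (V (by₁ , exposed)) (V (by₂ , by₁)) (V (by₂ , by₂))
  (V (by₂ , exposed)) (V (exposed , by₁)) (V (exposed , by₂)) (V (exposed , exposed))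
  where
  shape : ∀ w v₁ v₂ v₃ v₄ v₅ v₆ v₇ v₈ v₉ →
    w * 0 * v₁ + (w * 1 * v₂ + (w * 1 * v₃ + (w * 0 * v₄ + (w * 0 * v₅ + (w * 0 * v₆ + (w * 0 * v₇ + (w * 0 * v₈ + (w * 0 * v₉ + 0))))))))
    ≡ w * (v₂ + v₃)
  shape = solve-∀

Ψvec-components : ∀ E Ae f Be i → Ψvec E labelA labelB [] Ae (f ∷ []) Be i ≡ Ψ E (deleted i) [] Ae (required i ++ f ∷ []) Be
Ψvec-components E Ae f Be zero = refl
Ψvec-components E Ae f Be (suc zero) = refl
Ψvec-components E Ae f Be (suc (suc zero)) = refl
Ψvec-components E Ae f Be (suc (suc (suc zero))) = refl
Ψvec-components E Ae f Be (suc (suc (suc (suc zero)))) = refl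
Ψvec-components E Ae f Be (suc (suc (suc (suc (suc zero))))) = refl
Ψvec-components E Ae f Be (suc (suc (suc (suc (suc (suc zero)))))) = refl
Ψvec-components E Ae f Be (suc (suc (suc (suc (suc (suc (suc zero))))))) = refl
Ψvec-components E Ae f Be (suc (suc (suc (suc (suc (suc (suc (suc zero)))))))) = refl

avoids-small : ∀ {a b D} → 2 ≤ a → 2 ≤ b → All (_< 2) D → any (incident (a , b)) D ≡ false
avoids-small 2≤a 2≤b [] = refl
avoids-small 2≤a 2≤b (v<2 ∷ vs) =
  cong₂ _∨_ (cong₂ _∨_ (≡ᵇ-false (big≢small 2≤a v<2)) (≡ᵇ-false (big≢small 2≤b v<2))) (avoids-small 2≤a 2≤b vs)
  where
  big≢small : ∀ {a v} → 2 ≤ a → v < 2 → a ≢ v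
  big≢small 2≤a v<2 refl = <⇒≱ v<2 2≤a

module Ring (N e d c f dK cK : ℕ) (EK : List Edge) where
  open Attachment N d c dK cK EK

  ψ : ℕ
  ψ = Ψ EK (dK ∷ []) [] [] [] []

  chainCount : (x y b : ℕ) → List Turn → State → ℕ
  chainCount x y b ts α = Φ (chainEdges x y b ts ++ Kr) (select by₁ α x y []) (select exposed α x y []) ((f , c) ∷ [])
                      (select by₂ α x y (f ∷ [])) ((e , d) ∷ [])

  rest-far : ∀ w u b′ ts → b′ ≤ d → b′ ≤ c → b′ ≤ N → All (FarEdge w u b′) (chainEdges w u b′ ts ++ Kr)
  rest-far w u b′ ts b′≤d b′≤c b′≤N =
    ++⁺ (chain-far w u b′ ts) (All.map (λ (fa , fb) → far-shift b′≤d b′≤c b′≤N fa , far-shift b′≤d b′≤c b′≤N fb) Kr-far)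

  mid-split : ∀ {x y b} t t′ ts → x < b → y < b → x ≢ y →
    edcfOf (lastHex (exitW x y b t) (exitU x y b t) (4 + b) t′ ts) ≡ edcf e d c f → 4 + b ≤ N →
    ∀ α → chainCount x y b (t ∷ t′ ∷ ts) α
          ≡ ∑[ β ∈ states ] (transferTable t α β * chainCount (exitW x y b t) (exitU x y b t) (4 + b) (t′ ∷ ts) β)
  mid-split {x} {y} {b} t t′ ts x<b y<b x≢y last 4+b≤N α = begin
    chainCount x y b (t ∷ t′ ∷ ts) α
      ≡⟨ cong₂ (λ S B → Φ S X Av ((f , c) ∷ []) B ((e , d) ∷ [])) (++-assoc H C Kr) (sym (select-++ by₂ α x y (f ∷ []))) ⟩
    Φ (H ++ (C ++ Kr)) X Av ((f , c) ∷ []) (select by₂ α x y [] ++ f ∷ []) ((e , d) ∷ [])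
      ≡⟨ Φ-split H (C ++ Kr) X Av (select by₂ α x y []) (f ∷ []) [] [] ((f , c) ∷ []) ((e , d) ∷ [])
           (hex-below x<b y<b) (rest-far w u (4 + b) (t′ ∷ ts) 4+b≤d 4+b≤c 4+b≤N)
           (All-select by₁ α x-inner y-inner []) (All-select exposed α x-inner y-inner [])
           (All-select by₂ α x-inner y-inner []) (f-far ∷ []) [] [] (inj₂ 4+b≤c ∷ []) (inj₂ 4+b≤d ∷ []) ⟩
    ∑[ β ∈ states ] (hexagonCount H x y α w u β [] [] [] * chainCount w u (4 + b) (t′ ∷ ts) β)
      ≡⟨ ∑-ext (λ β → cong (_* chainCount w u (4 + b) (t′ ∷ ts) β) (relabel β)) states ⟩
    ∑[ β ∈ states ] (transferTable t α β * chainCount w u (4 + b) (t′ ∷ ts) β) ∎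
    where
    open ≡-Reasoning
    open Exit (exit x y b t)
    w = exitW x y b t
    u = exitU x y b t
    open Interface w u (4 + b) w≢u w<4+b u<4+b
    H = hexEdges (hexPath x y b)
    C = chainEdges w u (4 + b) (t′ ∷ ts)
    X = select by₁ α x y []
    Av = select exposed α x y []
    x-inner = below-inner x<b b≤w b≤u (m≤n+m b 4)
    y-inner = below-inner y<b b≤w b≤u (m≤n+m b 4)
    f-far = proj₁ (closing-far w u (4 + b) t′ ts last)
    4+b≤d = proj₁ (proj₂ (closing-far w u (4 + b) t′ ts last))
    4+b≤c = proj₂ (proj₂ (closing-far w u (4 + b) t′ ts last))
    relabel : ∀ β → hexagonCount H x y α w u β [] [] [] ≡ transferTable t α β
    relabel β = trans (cong₂ (λ w u → hexagonCount H x y α w u β [] [] []) (proj₁ (exit-hexLabel x y b t)) (proj₂ (exit-hexLabel x y b t)))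
                      (hexagonCount-relabel x<b y<b x≢y α (outW t) (outU t) β [] [] [])

  closing-split : ∀ {x y b} t → x < b → y < b → x ≢ y → edcfOf (hexPath x y b , t) ≡ edcf e d c f → 4 + b ≤ N →
    ∀ α → chainCount x y b (t ∷ []) α ≡ ∑[ γ ∈ states ] (closingTable t α γ * Kvec γ)
  closing-split {x} {y} {b} t x<b y<b x≢y last 4+b≤N α = begin
    chainCount x y b (t ∷ []) α
      ≡⟨ cong (λ B → Φ (H ++ Kr) X Av ((f , c) ∷ []) B ((e , d) ∷ [])) (sym (++-identityʳ (select by₂ α x y (f ∷ [])))) ⟩
    Φ (H ++ Kr) X Av ((f , c) ∷ []) (select by₂ α x y (f ∷ []) ++ []) ((e , d) ∷ [])
      ≡⟨ Φ-split H Kr X Av (select by₂ α x y (f ∷ [])) [] ((f , c) ∷ []) ((e , d) ∷ []) [] []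
           (All.map (λ (a<4+b , b<4+b) → <-≤-trans a<4+b 4+b≤N , <-≤-trans b<4+b 4+b≤N) (hex-below x<b y<b)) Kr-far
           (All-select by₁ α x-inner y-inner []) (All-select exposed α x-inner y-inner [])
           (All-select by₂ α x-inner y-inner (f-inner ∷ [])) [] (inj₁ f-inner ∷ []) (inj₁ e-inner ∷ []) [] [] ⟩
    ∑[ γ ∈ states ] (hexagonCount H x y α d c γ ((f , c) ∷ []) (f ∷ []) ((e , d) ∷ []) * Kvec γ)
      ≡⟨ ∑-ext (λ γ → cong (_* Kvec γ) (relabel γ)) states ⟩
    ∑[ γ ∈ states ] (closingTable t α γ * Kvec γ) ∎
    where
    open ≡-Reasoning
    open ClosingHexagon (closing-hexagon x y b t x<b y<b 4+b≤N last)
    open Exit dc-exit renaming (w≢u to c≢d; w<4+b to c<4+b; u<4+b to d<4+b; b≤w to b≤c; b≤u to b≤d)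
    open Interface d c N (c≢d ∘ sym) (<-≤-trans d<4+b 4+b≤N) (<-≤-trans c<4+b 4+b≤N)
    H = hexEdges (hexPath x y b)
    X = select by₁ α x y []
    Av = select exposed α x y []
    b≤N = ≤-trans (m≤n+m b 4) 4+b≤N
    x-inner = below-inner x<b b≤d b≤c b≤N
    y-inner = below-inner y<b b≤d b≤c b≤N
    E₀ = edcfOf (hexPath 0 1 2 , t)
    relabel : ∀ γ → hexagonCount H x y α d c γ ((f , c) ∷ []) (f ∷ []) ((e , d) ∷ []) ≡ closingTable t α γ
    relabel γ = subst (λ r → hexagonCount H x y α (EDCF.vd r) (EDCF.vc r) γ ((EDCF.vf r , EDCF.vc r) ∷ []) (EDCF.vf r ∷ [])
                                          ((EDCF.ve r , EDCF.vd r) ∷ []) ≡ closingTable t α γ)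
                      (trans (sym (edcf-hexLabel x y b t)) last)
                      (hexagonCount-relabel x<b y<b x≢y α (EDCF.vd E₀) (EDCF.vc E₀) γ
                         ((EDCF.vf E₀ , EDCF.vc E₀) ∷ []) (EDCF.vf E₀ ∷ []) ((EDCF.ve E₀ , EDCF.vd E₀) ∷ []))

  chain-transfer : ∀ {n} t (ts : Vec Turn n) {x y b} → x < b → y < b → x ≢ y →
    edcfOf (lastHex x y b t (toList ts)) ≡ edcf e d c f → 4 + b + 4 * n ≤ N →
    ∀ k → ∑[ α ∈ states ] (basis k α * chainCount x y b (t ∷ toList ts) α) ≡ ringMatrix (t ∷ ts) k (suc zero) * ψ
  chain-transfer t [] {x} {y} {b} x<b y<b x≢y last bound k = begin
    ∑[ α ∈ states ] (basis k α * chainCount x y b (t ∷ []) α)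
      ≡⟨ ∑-ext (λ α → cong (basis k α *_) (closing-split t x<b y<b x≢y last 4+b≤N α)) states ⟩
    ∑[ α ∈ states ] (basis k α * ∑[ γ ∈ states ] (closingTable t α γ * Kvec γ))
      ≡⟨ ∑-*-∑ states states (basis k) (closingTable t) Kvec ⟩
    ∑[ γ ∈ states ] (∑[ α ∈ states ] (basis k α * closingTable t α γ) * Kvec γ)
      ≡⟨ ∑-ext (λ γ → cong (_* Kvec γ) (closing-table t k γ)) states ⟩
    ∑[ γ ∈ states ] (fM t k (suc zero) * closingWeight γ * Kvec γ)
      ≡⟨ closingWeight-∑ (fM t k (suc zero)) Kvec ⟩
    fM t k (suc zero) * (Kvec (by₁ , by₂) + Kvec (by₁ , exposed))
      ≡⟨ cong₂ _*_ (sym (column₁-identityʳ (fM t) k)) (Kvec-closing (c≢d ∘ sym) (<-≤-trans d<4+b 4+b≤N) (<-≤-trans c<4+b 4+b≤N)) ⟩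
    ringMatrix (t ∷ []) k (suc zero) * ψ ∎
    where
    open ≡-Reasoning
    4+b≤N = subst (_≤ N) (+-identityʳ (4 + b)) bound
    open ClosingHexagon (closing-hexagon x y b t x<b y<b 4+b≤N last)
    open Exit dc-exit renaming (w≢u to c≢d; w<4+b to c<4+b; u<4+b to d<4+b)
  chain-transfer {suc n} t (t′ ∷ ts) {x} {y} {b} x<b y<b x≢y last bound k = begin
    ∑[ α ∈ states ] (basis k α * chainCount x y b (t ∷ t′ ∷ toList ts) α)
      ≡⟨ ∑-ext (λ α → cong (basis k α *_) (mid-split t t′ (toList ts) x<b y<b x≢y last 4+b≤N α)) states ⟩
    ∑[ α ∈ states ] (basis k α * ∑[ β ∈ states ] (transferTable t α β * chainCount w u (4 + b) (t′ ∷ toList ts) β))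
      ≡⟨ ∑-*-∑ states states (basis k) (transferTable t) (chainCount w u (4 + b) (t′ ∷ toList ts)) ⟩
    ∑[ β ∈ states ] (∑[ α ∈ states ] (basis k α * transferTable t α β) * chainCount w u (4 + b) (t′ ∷ toList ts) β)
      ≡⟨ factor-through-basis _ (chainCount w u (4 + b) (t′ ∷ toList ts)) (fM t k) (λ m → ringMatrix (t′ ∷ ts) m (suc zero)) ψ
           (transfer-table t k) (chain-transfer t′ ts w<4+b u<4+b w≢u last bound′) ⟩
    ringMatrix (t ∷ t′ ∷ ts) k (suc zero) * ψ ∎
    where
    open ≡-Reasoning
    open Exit (exit x y b t)
    w = exitW x y b t
    u = exitU x y b t
    bound′ : 4 + (4 + b) + 4 * n ≤ N
    bound′ = subst (_≤ N) (shift b n) bound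
      where
      shift : ∀ b n → 4 + b + 4 * suc n ≡ 4 + (4 + b) + 4 * n
      shift = solve-∀
    4+b≤N = ≤-trans (m≤m+n (4 + b) (4 * suc n)) bound

  first-split : ∀ {n} t t′ (ts : Vec Turn n) → edcfOf (lastHex (outW t) (outU t) 6 t′ (toList ts)) ≡ edcf e d c f → 6 ≤ N →
    ∀ i → Φ (edgesMinus (chainG (t ∷ t′ ∷ toList ts) ++ Kr) (deleted i)) [] [] ((f , c) ∷ []) (required i ++ f ∷ []) ((e , d) ∷ [])
          ≡ ∑[ α ∈ states ] (firstTable t i α * chainCount (outW t) (outU t) 6 (t′ ∷ toList ts) α)
  first-split t t′ ts last 6≤N i = begin
    Φ (edgesMinus (((1 , 0) ∷ H₀ ++ C) ++ Kr) D) [] [] ((f , c) ∷ []) (required i ++ f ∷ []) ((e , d) ∷ [])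
      ≡⟨ cong (λ S → Φ S [] [] ((f , c) ∷ []) (required i ++ f ∷ []) ((e , d) ∷ [])) split-edges ⟩
    Φ (edgesMinus ((1 , 0) ∷ H₀) D ++ (C ++ Kr)) [] [] ((f , c) ∷ []) (required i ++ f ∷ []) ((e , d) ∷ [])
      ≡⟨ Φ-split (edgesMinus ((1 , 0) ∷ H₀) D) (C ++ Kr) [] [] (required i) (f ∷ []) [] [] ((f , c) ∷ []) ((e , d) ∷ [])
           (filter⁺ (avoids? D) top-below) rest [] [] (All.map (λ v<2 → below-inner v<2 2≤w 2≤u (m≤n+m 2 4)) (required-<2 i))
           (f-far ∷ []) [] [] (inj₂ 6≤c ∷ []) (inj₂ 6≤d ∷ []) ⟩
    ∑[ α ∈ states ] (firstTable t i α * chainCount w u 6 (t′ ∷ toList ts) α) ∎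
    where
    open ≡-Reasoning
    open Exit (exit 0 1 2 t) renaming (b≤w to 2≤w; b≤u to 2≤u)
    w = outW t
    u = outU t
    open Interface w u 6 w≢u w<4+b u<4+b
    D = deleted i
    C = chainEdges w u 6 (t′ ∷ toList ts)
    f-far = proj₁ (closing-far w u 6 t′ (toList ts) last)
    6≤d = proj₁ (proj₂ (closing-far w u 6 t′ (toList ts) last))
    6≤c = proj₂ (proj₂ (closing-far w u 6 t′ (toList ts) last))
    rest = rest-far w u 6 (t′ ∷ toList ts) 6≤d 6≤c 6≤N
    top-below : All (EdgeBelow 6) ((1 , 0) ∷ H₀)
    top-below = (<-≤-trans 1<2 (m≤n+m 2 4) , <-≤-trans 0<2 (m≤n+m 2 4)) ∷ hex-below 0<2 1<2
    far-big : ∀ {v} → Far w u 6 v → 2 ≤ v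
    far-big (at-p refl) = 2≤w
    far-big (at-q refl) = 2≤u
    far-big (outside 6≤v) = ≤-trans (m≤n+m 2 4) 6≤v
    avoids : All (Avoids D) (C ++ Kr)
    avoids = All.map (λ (fa , fb) → subst (T ∘ not) (sym (avoids-small (far-big fa) (far-big fb) (deleted-<2 i))) _) rest
    split-edges : edgesMinus (((1 , 0) ∷ H₀ ++ C) ++ Kr) D ≡ edgesMinus ((1 , 0) ∷ H₀) D ++ (C ++ Kr)
    split-edges = begin
      edgesMinus (((1 , 0) ∷ H₀ ++ C) ++ Kr) D                    ≡⟨ cong (λ L → edgesMinus ((1 , 0) ∷ L) D) (++-assoc H₀ C Kr) ⟩
      edgesMinus (((1 , 0) ∷ H₀) ++ (C ++ Kr)) D                  ≡⟨ filter-++ (avoids? D) ((1 , 0) ∷ H₀) (C ++ Kr) ⟩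
      edgesMinus ((1 , 0) ∷ H₀) D ++ edgesMinus (C ++ Kr) D       ≡⟨ cong (edgesMinus ((1 , 0) ∷ H₀) D ++_) (filter-all (avoids? D) avoids) ⟩
      edgesMinus ((1 , 0) ∷ H₀) D ++ (C ++ Kr)                    ∎

lemma2 : (n : ℕ) → 3 ≤ n → (ks : Vec Turn n) →
    (EK : List Edge) (dK cK : ℕ) → Simple EK → dK ≢ cK → (dK , cK) ∈E EK →
    let ts = toList ks
        G = chainG ts
        N = nVertG ts
        p = ringEDCF ts
        e = EDCF.ve p
        d = EDCF.vd p
        c = EDCF.vc p
        f = EDCF.vf p
        F = glue G N d c EK dK cK
    in (i : Fin 9) →
       Ψvec F labelA labelB [] ((f , c) ∷ []) (f ∷ []) ((e , d) ∷ []) i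
         ≡ ringMatrix ks i (suc zero) * Ψ EK (dK ∷ []) [] [] [] []
lemma2 (suc (suc (suc m))) (s≤s (s≤s (s≤s z≤n))) (t ∷ t′ ∷ ks) EK dK cK _ _ _ i = begin
  Ψvec F labelA labelB [] ((f , c) ∷ []) (f ∷ []) ((e , d) ∷ []) i
    ≡⟨ Ψvec-components F ((f , c) ∷ []) f ((e , d) ∷ []) i ⟩
  Ψ F (deleted i) [] ((f , c) ∷ []) (required i ++ f ∷ []) ((e , d) ∷ [])
    ≡⟨ Ψ≡Φ F (deleted i) [] ((f , c) ∷ []) (required i ++ f ∷ []) ((e , d) ∷ []) ⟩
  Φ (edgesMinus F (deleted i)) [] [] ((f , c) ∷ []) (required i ++ f ∷ []) ((e , d) ∷ [])
    ≡⟨ first-split t t′ ks refl (≤-trans (m≤n+m 6 4) (≤-trans (m≤m+n 10 (4 * suc m)) bound)) i ⟩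
  ∑[ α ∈ states ] (firstTable t i α * chainCount (outW t) (outU t) 6 (t′ ∷ toList ks) α)
    ≡⟨ factor-through-basis (firstTable t i) (chainCount (outW t) (outU t) 6 (t′ ∷ toList ks)) (fM t i) (λ k → ringMatrix (t′ ∷ ks) k (suc zero)) ψ
         (first-table t i) (chain-transfer t′ ks w<4+b u<4+b w≢u refl bound) ⟩
  ringMatrix (t ∷ t′ ∷ ks) i (suc zero) * ψ ∎
  where
  open ≡-Reasoning
  ts = t ∷ t′ ∷ toList ks
  N = nVertG ts
  p = ringEDCF ts
  e = EDCF.ve p
  d = EDCF.vd p
  c = EDCF.vc p
  f = EDCF.vf p
  F = glue (chainG ts) N d c EK dK cK
  open Ring N e d c f dK cK EK
  open Exit (exit 0 1 2 t)
  bound : 4 + 6 + 4 * suc m ≤ N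
  bound = ≤-reflexive (trans (count m) (cong (λ L → 2 + 4 * suc (suc L)) (sym (length-toList ks))))
    where
    count : ∀ m → 4 + 6 + 4 * suc m ≡ 2 + 4 * suc (suc (suc m))
    count = solve-∀
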